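{- Let $n \ge 3$ and $G = L(W_{1,n})$, where $W_{1,n} = C_n + K_1$ is the wheel graph. Then for every edge $e \in E(G)$, $Z(G - e) = n$, where $G - e$ is the graph obtained from $G$ by deleting the edge $e$ (keeping all vertices).
   Context: $W_{1,n} = C_n + K_1$ is the join of the cycle $C_n$ with one extra vertex adjacent to all vertices of $C_n$. $L(W_{1,n})$ is its line graph (vertex set $E(W_{1,n})$, adjacency meaning sharing an endpoint). Zero forcing: each vertex of a graph $H$ is colored black or white; if a black vertex $u$ has exactly one white neighbor $w$, then $w$ becomes black (color-change rule). $S \subseteq V(H)$ is a zero forcing set if, starting with exactly $S$ black, repeated application of the rule makes every vertex black. $Z(H)$ is the minimum size of a zero forcing set of $H$. -}

module Defs where

open import Data.Nat using (ℕ; zero; suc; _≤_; _%_; _≡ᵇ_)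
open import Data.Fin using (Fin; zero; suc; toℕ; _<_)
open import Data.Fin.Properties using (_<?_)
open import Data.Bool using (Bool; true; false; T; _∨_; _∧_)
open import Data.Product using (Σ; _×_; _,_; proj₁; proj₂; ∃-syntax)
open import Data.Sum using (_⊎_)
open import Data.List using (List; length)
open import Data.List.Membership.Propositional using (_∈_)
open import Data.List.Relation.Unary.Unique.Propositional using (Unique)
open import Relation.Nullary using (¬_)
open import Relation.Nullary.Decidable using (⌊_⌋)
open import Relation.Binary.PropositionalEquality using (_≡_; _≢_)

record Graph : Set₁ where
  field
    V   : Set
    Adj : V → V → Set
open Graph public

-- Wheel W_{1,n} = C_n + K_1 on vertex set Fin (suc n):
-- vertex zero is the hub, vertex (suc i) is cycle vertex i (i : Fin n);
-- cycle vertices i, j are adjacent iff j ≡ i+1 (mod n) or i ≡ j+1 (mod n).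

cycAdj : (n : ℕ) → Fin n → Fin n → Bool
cycAdj (suc m) i j =
  (toℕ j ≡ᵇ (suc (toℕ i) % suc m)) ∨ (toℕ i ≡ᵇ (suc (toℕ j) % suc m))

wheelAdj : (n : ℕ) → Fin (suc n) → Fin (suc n) → Bool
wheelAdj n zero    zero    = false
wheelAdj n zero    (suc j) = true
wheelAdj n (suc i) zero    = true
wheelAdj n (suc i) (suc j) = cycAdj n i j

-- Edge set of the wheel: pairs (a , b) with a < b that are adjacent
-- (each unordered edge {a,b} represented exactly once).
WheelEdge : ℕ → Set
WheelEdge n = Σ (Fin (suc n) × Fin (suc n))
  λ p → T (⌊ proj₁ p <? proj₂ p ⌋ ∧ wheelAdj n (proj₁ p) (proj₂ p))

shareEnd : ∀ {n} → WheelEdge n → WheelEdge n → Set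
shareEnd ((a , b) , _) ((c , d) , _) =
  (a ≡ c) ⊎ (a ≡ d) ⊎ (b ≡ c) ⊎ (b ≡ d)

LW : ℕ → Graph
LW n = record
  { V   = WheelEdge n
  ; Adj = λ e f → (e ≢ f) × shareEnd e f
  }

deleteEdge : (G : Graph) → V G → V G → Graph
deleteEdge G x y = record
  { V   = V G
  ; Adj = λ u v → Adj G u v × ¬ (((u ≡ x) × (v ≡ y)) ⊎ ((u ≡ y) × (v ≡ x)))
  }

-- Black G S v : vertex v is black in the final colouring
-- obtained from initial black set S by repeatedly applying the
-- colour-change rule (least set containing S and closed under the rule:
-- if u is black and every neighbour of u other than w is black, then
-- the neighbour w becomes black).

data Black (G : Graph) (S : List (V G)) : V G → Set where
  init  : ∀ {v} → v ∈ S → Black G S v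
  force : ∀ {u w} → Black G S u → Adj G u w →
          (∀ v → Adj G u v → v ≢ w → Black G S v) → Black G S w

IsZFS : (G : Graph) → List (V G) → Set
IsZFS G S = ∀ v → Black G S v

ZeroForcingNumberIs : Graph → ℕ → Set
ZeroForcingNumberIs G k =
  (∃[ S ] (Unique S × length S ≡ k × IsZFS G S)) ×
  (∀ S → Unique S → IsZFS G S → k ≤ length S)

module Submission where

-- Z(G − e) ≥ n: if A is an integer matrix whose off-diagonal nonzero pattern is the adjacency
-- relation of a graph H, a null vector of A that vanishes on S vanishes on every vertex forced
-- from S, since the row of the forcing vertex then has a single possibly nonzero term. When A has
-- n linearly independent null vectors, some nonzero combination of them vanishes on any set of
-- fewer than n vertices, so such a set is not zero forcing. For H = L(W_{1,n}) − e such a matrix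
-- exists: away from the endpoints of e it has fixed "standard" rows, and its null vectors x_t
-- (t ∈ ℤ_n) have rim coordinates δ_t. Z(G − e) ≤ n: up to a rotation or reflection of the wheel,
-- e is spoke 0 – rim 0, rim 0 – rim 1 or spoke 0 – spoke q, and each case has an explicit zero
-- forcing set of size n.

open import Defs
open import Data.Empty using (⊥-elim)
open import Data.Fin as Fin using (Fin; zero; suc; toℕ; fromℕ; inject₁; opposite)
open import Data.Fin.Induction using (<-weakInduction; <-weakInduction-startingFrom)
open import Data.Fin.Relation.Unary.Top using (view; ‵fromℕ; ‵inject₁; view-fromℕ; view-inject₁)
import Data.Fin.Properties as Finₚ
open import Data.Bool using (T)
import Data.Bool.Properties as Boolₚ
open import Data.Integer as ℤ using (ℤ; +_; -_; _+_; _*_; _-_; 0ℤ; 1ℤ; -1ℤ)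
import Data.Integer.Properties as ℤₚ
open import Data.Integer.Tactic.RingSolver using (solve-∀)
open import Data.List using (List; []; _∷_; length; map; tabulate)
open import Data.List.Relation.Unary.Unique.Propositional using (Unique)
open import Data.List.Relation.Unary.AllPairs using (_∷_)
import Data.List.Relation.Unary.All.Properties as Allₚ
open import Data.List.Membership.Propositional using (_∈_)
import Data.List.Membership.Propositional.Properties as ∈ₚ
open import Data.List.Relation.Unary.Any using (here; there)
import Data.List.Properties as Listₚ
import Data.List.Relation.Unary.Unique.Propositional.Properties as Uniqueₚ
open import Data.Nat as ℕ using (ℕ; zero; suc; _≤_; z≤n; s≤s)
import Data.Nat.Properties as ℕₚ
open import Data.Nat.DivMod using (n%n≡0; m<n⇒m%n≡m)
open import Data.Product using (_×_; _,_; proj₁; proj₂; ∃-syntax)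
open import Data.Sum using (_⊎_; inj₁; inj₂)
import Data.Sum as ⊎
import Data.Product as ×
open import Function using (_∘_)
open import Function.Bundles using (Equivalence)
open import Relation.Binary.Definitions using (DecidableEquality)
open import Relation.Binary.PropositionalEquality
open import Relation.Nullary using (¬_; Dec; yes; no)
open import Relation.Nullary.Decidable using (⌊_⌋; fromWitness; toWitness)

open import Algebra.Properties.Semiring.Sum ℤₚ.+-*-semiring
  using (sum; sum-cong-≗; ∑-distrib-+; ∑-comm; *-distribˡ-sum; sum-replicate-zero)

record _≅_ (G H : Graph) : Set where
  field
    to       : V G → V H
    from     : V H → V G
    from∘to  : ∀ u → from (to u) ≡ u
    to∘from  : ∀ v → to (from v) ≡ v
    to-adj   : ∀ {u v} → Adj G u v → Adj H (to u) (to v)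
    from-adj : ∀ {u v} → Adj H u v → Adj G (from u) (from v)

  to-injective : ∀ {u v} → to u ≡ to v → u ≡ v
  to-injective {u} {v} eq = trans (sym (from∘to u)) (trans (cong from eq) (from∘to v))

  from-injective : ∀ {u v} → from u ≡ from v → u ≡ v
  from-injective {u} {v} eq = trans (sym (to∘from u)) (trans (cong to eq) (to∘from v))

open _≅_

≅-refl : ∀ {G} → G ≅ G
≅-refl = record
  { to = λ u → u ; from = λ u → u ; from∘to = λ _ → refl ; to∘from = λ _ → refl
  ; to-adj = λ a → a ; from-adj = λ a → a }

≅-sym : ∀ {G H} → G ≅ H → H ≅ G
≅-sym φ = record
  { to = from φ ; from = to φ ; from∘to = to∘from φ ; to∘from = from∘to φ
  ; to-adj = from-adj φ ; from-adj = to-adj φ }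

≅-trans : ∀ {G H K} → G ≅ H → H ≅ K → G ≅ K
≅-trans φ ψ = record
  { to = λ u → to ψ (to φ u) ; from = λ w → from φ (from ψ w)
  ; from∘to = λ u → trans (cong (from φ) (from∘to ψ (to φ u))) (from∘to φ u)
  ; to∘from = λ w → trans (cong (to ψ) (to∘from φ (from ψ w))) (to∘from ψ w)
  ; to-adj = λ a → to-adj ψ (to-adj φ a) ; from-adj = λ a → from-adj φ (from-adj ψ a) }

Black-≅ : ∀ {G H} (φ : G ≅ H) {S w} → Black G S w → Black H (map (to φ) S) (to φ w)
Black-≅ φ (init w∈S) = init (∈ₚ.∈-map⁺ (to φ) w∈S)
Black-≅ {G} {H} φ {S} (force {u} bu u~w rest) = force (Black-≅ φ bu) (to-adj φ u~w) rest′
  where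
  rest′ : ∀ v → Adj H (to φ u) v → v ≢ _ → Black H (map (to φ) S) v
  rest′ v u~v v≢w = subst (Black H (map (to φ) S)) (to∘from φ v)
    (Black-≅ φ (rest (from φ v) (subst (λ x → Adj G x (from φ v)) (from∘to φ u) (from-adj φ u~v))
                     (λ eq → v≢w (trans (sym (to∘from φ v)) (cong (to φ) eq)))))

IsZFS-≅ : ∀ {G H} (φ : G ≅ H) {S} → IsZFS G S → IsZFS H (map (to φ) S)
IsZFS-≅ {H = H} φ zfs v = subst (Black H _) (to∘from φ v) (Black-≅ φ (zfs (from φ v)))

ZeroForcingNumberIs-≅ : ∀ {G H k} → G ≅ H → ZeroForcingNumberIs G k → ZeroForcingNumberIs H k
ZeroForcingNumberIs-≅ φ ((S , unique , |S|≡k , zfs) , minimal) =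
  ( map (to φ) S , Uniqueₚ.map⁺ (to-injective φ) unique
  , trans (Listₚ.length-map (to φ) S) |S|≡k , IsZFS-≅ φ zfs )
  , λ S′ unique′ zfs′ → subst (_ ℕ.≤_) (Listₚ.length-map (from φ) S′)
      (minimal (map (from φ) S′) (Uniqueₚ.map⁺ (from-injective φ) unique′) (IsZFS-≅ (≅-sym φ) zfs′))

deleteEdge-≅ : ∀ {G H} (φ : G ≅ H) x y → deleteEdge G x y ≅ deleteEdge H (to φ x) (to φ y)
deleteEdge-≅ φ x y = record
  { to = to φ ; from = from φ ; from∘to = from∘to φ ; to∘from = to∘from φ
  ; to-adj   = λ (u~v , u≁v) → to-adj φ u~v , u≁v ∘ ⊎.map (×.map (to-injective φ) (to-injective φ))
                                                            (×.map (to-injective φ) (to-injective φ))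
  ; from-adj = λ (u~v , u≁v) → from-adj φ u~v , u≁v ∘ ⊎.map (×.map from≡⇒≡to from≡⇒≡to)
                                                              (×.map from≡⇒≡to from≡⇒≡to) }
  where
  from≡⇒≡to : ∀ {u x} → from φ u ≡ x → u ≡ to φ x
  from≡⇒≡to {u} eq = trans (sym (to∘from φ u)) (cong (to φ) eq)

deleteEdge-comm : ∀ G x y → deleteEdge G x y ≅ deleteEdge G y x
deleteEdge-comm G x y = record
  { to = λ u → u ; from = λ u → u ; from∘to = λ _ → refl ; to∘from = λ _ → refl
  ; to-adj = λ (u~v , u≁v) → u~v , u≁v ∘ ⊎.swap
  ; from-adj = λ (u~v , u≁v) → u~v , u≁v ∘ ⊎.swap }

deleteEdge-transport : ∀ {G H k} (φ : G ≅ H) x y →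
  ZeroForcingNumberIs (deleteEdge H (to φ x) (to φ y)) k → ZeroForcingNumberIs (deleteEdge G x y) k
deleteEdge-transport φ x y = ZeroForcingNumberIs-≅ (≅-sym (deleteEdge-≅ φ x y))

-- Null vectors of a matrix with the off-diagonal pattern of a graph

module NullVector
  (G : Graph) (_≟_ : DecidableEquality (V G))
  (∑ : (V G → ℤ) → ℤ) (∑-single : ∀ w f → (∀ v → v ≢ w → f v ≡ 0ℤ) → ∑ f ≡ f w)
  (A : V G → V G → ℤ)
  (A-adj : ∀ {u v} → Adj G u v → A u v ≢ 0ℤ)
  (A-support : ∀ {u v} → u ≢ v → A u v ≢ 0ℤ → Adj G u v)
  where

  null-vanishes-on-Black : ∀ (y : V G → ℤ) → (∀ u → ∑ (λ v → A u v * y v) ≡ 0ℤ) →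
    ∀ {S} → (∀ {v} → v ∈ S → y v ≡ 0ℤ) → ∀ {w} → Black G S w → y w ≡ 0ℤ
  null-vanishes-on-Black y Ay≡0 y|S≡0 (init w∈S) = y|S≡0 w∈S
  null-vanishes-on-Black y Ay≡0 y|S≡0 (force {u} {w} bu u~w rest)
    with ℤₚ.i*j≡0⇒i≡0∨j≡0 (A u w) (trans (sym (∑-single w (λ v → A u v * y v) other-terms)) (Ay≡0 u))
    where
    IH = null-vanishes-on-Black y Ay≡0 y|S≡0
    other-terms : ∀ v → v ≢ w → A u v * y v ≡ 0ℤ
    other-terms v v≢w with v ≟ u | A u v ℤ.≟ 0ℤ
    ... | yes refl | _      = trans (cong (A v v *_) (IH bu)) (ℤₚ.*-zeroʳ (A v v))
    ... | no v≢u   | yes a≡0 = trans (cong (_* y v) a≡0) (ℤₚ.*-zeroˡ (y v))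
    ... | no v≢u   | no a≢0 =
      trans (cong (A u v *_) (IH (rest v (A-support (v≢u ∘ sym) a≢0) v≢w))) (ℤₚ.*-zeroʳ (A u v))
  ... | inj₁ A≡0 = ⊥-elim (A-adj u~w A≡0)
  ... | inj₂ y≡0 = y≡0

-- Fewer homogeneous linear equations than unknowns

_·_ : ∀ {n} → (Fin n → ℤ) → (Fin n → ℤ) → ℤ
φ · l = sum (λ i → φ i * l i)

private
  data Pivot {n} (Φ : List (Fin (suc n) → ℤ)) : Set where
    no-pivot : (∀ {φ} → φ ∈ Φ → φ zero ≡ 0ℤ) → Pivot Φ
    pivot    : ∀ φ₀ Φ′ → φ₀ zero ≢ 0ℤ → length Φ ≡ suc (length Φ′) →
               (∀ {φ} → φ ∈ Φ → φ ≡ φ₀ ⊎ φ ∈ Φ′) → Pivot Φ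

  find-pivot : ∀ {n} (Φ : List (Fin (suc n) → ℤ)) → Pivot Φ
  find-pivot [] = no-pivot (λ ())
  find-pivot (φ ∷ Φ) with φ zero ℤ.≟ 0ℤ
  ... | no φ₀≢0 = pivot φ Φ φ₀≢0 refl λ { (here eq) → inj₁ eq ; (there φ∈Φ) → inj₂ φ∈Φ }
  ... | yes φ₀≡0 with find-pivot Φ
  ...   | no-pivot all≡0 = no-pivot λ { (here refl) → φ₀≡0 ; (there ψ∈Φ) → all≡0 ψ∈Φ }
  ...   | pivot ψ Ψ ψ₀≢0 len split =
            pivot ψ (φ ∷ Ψ) ψ₀≢0 (cong suc len)
                  λ { (here eq) → inj₂ (here eq) ; (there χ∈Φ) → ⊎.map₂ there (split χ∈Φ) }

-- Gaussian elimination on the first unknown: with pivot row φ₀ (p = φ₀ 0 ≢ 0), each other row φ is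
-- replaced by p φ(1+i) − φ 0 φ₀(1+i), and a solution l′ of the reduced system lifts to
-- l = (− φ₀(1+·) · l′ , p l′).
nontrivial-solution : ∀ n (Φ : List (Fin n → ℤ)) → length Φ ℕ.< n →
  ∃[ l ] (∃[ i ] l i ≢ 0ℤ) × (∀ {φ} → φ ∈ Φ → φ · l ≡ 0ℤ)
nontrivial-solution (suc n) Φ |Φ|<n with find-pivot Φ
... | no-pivot all≡0 = e₀ , (zero , λ ()) , λ {φ} φ∈Φ →
        cong₂ _+_ (cong (_* 1ℤ) (all≡0 φ∈Φ))
                  (trans (sum-cong-≗ (λ i → ℤₚ.*-zeroʳ (φ (suc i)))) (sum-replicate-zero n))
  where
  e₀ : Fin (suc n) → ℤ
  e₀ zero    = 1ℤ
  e₀ (suc i) = 0ℤ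
... | pivot φ₀ Φ′ p≢0 len split = l , (suc i′ , l-i′≢0) , l-solves
  where
  p = φ₀ zero
  tl : (Fin (suc n) → ℤ) → Fin n → ℤ
  tl φ i = φ (suc i)
  reduce : (Fin (suc n) → ℤ) → Fin n → ℤ
  reduce φ i = p * φ (suc i) - φ zero * φ₀ (suc i)
  reduced = nontrivial-solution n (map reduce Φ′)
    (subst (ℕ._< n) (sym (Listₚ.length-map reduce Φ′)) (subst (ℕ._≤ n) len (ℕₚ.≤-pred |Φ|<n)))
  l′ = proj₁ reduced
  i′ = proj₁ (proj₁ (proj₂ reduced))
  l : Fin (suc n) → ℤ
  l zero    = - (tl φ₀ · l′)
  l (suc i) = p * l′ i
  l-i′≢0 : p * l′ i′ ≢ 0ℤ
  l-i′≢0 eq = ⊎.[ p≢0 , proj₂ (proj₁ (proj₂ reduced)) ] (ℤₚ.i*j≡0⇒i≡0∨j≡0 p eq)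
  ·-l : ∀ φ → φ · l ≡ - (φ zero * (tl φ₀ · l′)) + p * (tl φ · l′)
  ·-l φ = cong₂ _+_ (sym (ℤₚ.neg-distribʳ-* (φ zero) (tl φ₀ · l′)))
    (trans (sum-cong-≗ λ i → swap-factor (φ (suc i)) p (l′ i)) (sym (*-distribˡ-sum p (λ i → φ (suc i) * l′ i))))
    where
    swap-factor : ∀ a p b → a * (p * b) ≡ p * (a * b)
    swap-factor = solve-∀
  ·-reduce : ∀ φ → reduce φ · l′ ≡ - (φ zero * (tl φ₀ · l′)) + p * (tl φ · l′)
  ·-reduce φ = begin
    sum (λ i → reduce φ i * l′ i)
      ≡⟨ sum-cong-≗ (λ i → expand p (φ (suc i)) (φ zero) (φ₀ (suc i)) (l′ i)) ⟩
    sum (λ i → p * (φ (suc i) * l′ i) + - φ zero * (φ₀ (suc i) * l′ i))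
      ≡⟨ ∑-distrib-+ (λ i → p * (φ (suc i) * l′ i)) (λ i → - φ zero * (φ₀ (suc i) * l′ i)) ⟩
    sum (λ i → p * (φ (suc i) * l′ i)) + sum (λ i → - φ zero * (φ₀ (suc i) * l′ i))
      ≡⟨ cong₂ _+_ (sym (*-distribˡ-sum p (λ i → φ (suc i) * l′ i)))
                   (sym (*-distribˡ-sum (- φ zero) (λ i → φ₀ (suc i) * l′ i))) ⟩
    p * (tl φ · l′) + - φ zero * (tl φ₀ · l′)
      ≡⟨ rearrange (p * (tl φ · l′)) (φ zero) (tl φ₀ · l′) ⟩
    - (φ zero * (tl φ₀ · l′)) + p * (tl φ · l′) ∎
    where
    open ≡-Reasoning
    expand : ∀ p a c b x → (p * a - c * b) * x ≡ p * (a * x) + - c * (b * x)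
    expand = solve-∀
    rearrange : ∀ q c d → q + - c * d ≡ - (c * d) + q
    rearrange = solve-∀
  l-solves : ∀ {φ} → φ ∈ Φ → φ · l ≡ 0ℤ
  l-solves {φ} φ∈Φ with split φ∈Φ
  ... | inj₁ refl = trans (·-l φ₀) (ℤₚ.+-inverseˡ (p * (tl φ₀ · l′)))
  ... | inj₂ φ∈Φ′ = trans (·-l φ) (trans (sym (·-reduce φ)) (proj₂ (proj₂ reduced) (∈ₚ.∈-map⁺ reduce φ∈Φ′)))

module _ {m : ℕ} where

  next : Fin (suc m) → Fin (suc m)
  next i with view i
  ... | ‵fromℕ     = zero
  ... | ‵inject₁ j = suc j

  prev : Fin (suc m) → Fin (suc m)
  prev zero    = fromℕ m
  prev (suc i) = inject₁ i

  next-fromℕ : next (fromℕ m) ≡ zero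
  next-fromℕ rewrite view-fromℕ m = refl

  next-inject₁ : ∀ j → next (inject₁ j) ≡ suc j
  next-inject₁ j rewrite view-inject₁ j = refl

  prev-next : ∀ i → prev (next i) ≡ i
  prev-next i with view i
  ... | ‵fromℕ     = refl
  ... | ‵inject₁ _ = refl

  next-prev : ∀ i → next (prev i) ≡ i
  next-prev zero    = next-fromℕ
  next-prev (suc i) = next-inject₁ i

  next-injective : ∀ {i j} → next i ≡ next j → i ≡ j
  next-injective {i} {j} eq = trans (sym (prev-next i)) (trans (cong prev eq) (prev-next j))

  prev-injective : ∀ {i j} → prev i ≡ prev j → i ≡ j
  prev-injective {i} {j} eq = trans (sym (next-prev i)) (trans (cong next eq) (next-prev j))

  toℕ-next : ∀ i → toℕ (next i) ≡ suc (toℕ i) ℕ.% suc m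
  toℕ-next i with view i
  ... | ‵fromℕ     = sym (trans (cong (λ k → suc k ℕ.% suc m) (Finₚ.toℕ-fromℕ m)) (n%n≡0 (suc m)))
  ... | ‵inject₁ j = sym (trans (cong (λ k → suc k ℕ.% suc m) (Finₚ.toℕ-inject₁ j))
                               (m<n⇒m%n≡m (s≤s (Finₚ.toℕ<n j))))

  opposite-inject₁ : ∀ (j : Fin m) → opposite (inject₁ j) ≡ suc (opposite j)
  opposite-inject₁ j = Finₚ.toℕ-injective (begin
    toℕ (opposite (inject₁ j))     ≡⟨ Finₚ.opposite-prop (inject₁ j) ⟩
    m ℕ.∸ toℕ (inject₁ j)          ≡⟨ cong (m ℕ.∸_) (Finₚ.toℕ-inject₁ j) ⟩
    m ℕ.∸ toℕ j                    ≡⟨ ℕₚ.+-∸-assoc 1 (Finₚ.toℕ<n j) ⟩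
    suc (m ℕ.∸ suc (toℕ j))        ≡⟨ cong suc (Finₚ.opposite-prop j) ⟨
    toℕ (suc (opposite j))         ∎)
    where open ≡-Reasoning

  opposite-next : ∀ i → opposite (next i) ≡ prev (opposite i)
  opposite-next i with view i
  ... | ‵fromℕ     = sym (cong prev (Finₚ.toℕ-injective (trans (Finₚ.opposite-prop (fromℕ m))
                                                          (trans (cong (m ℕ.∸_) (Finₚ.toℕ-fromℕ m)) (ℕₚ.n∸n≡0 m)))))
  ... | ‵inject₁ j = sym (cong prev (opposite-inject₁ j))

  next-opposite : ∀ (i : Fin (suc m)) → next (opposite i) ≡ opposite (prev i)
  next-opposite i = begin
    next (opposite i)                   ≡⟨ cong (next ∘ opposite) (next-prev i) ⟨
    next (opposite (next (prev i)))     ≡⟨ cong next (opposite-next (prev i)) ⟩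
    next (prev (opposite (prev i)))     ≡⟨ next-prev _ ⟩
    opposite (prev i)                   ∎
    where open ≡-Reasoning

  opposite-next-next : ∀ (i : Fin (suc m)) → opposite i ≡ next (opposite (next i))
  opposite-next-next i = sym (trans (next-opposite (next i)) (cong opposite (prev-next i)))

next≢id : ∀ {k} (i : Fin (2 ℕ.+ k)) → next i ≢ i
next≢id i with view i
... | ‵fromℕ     = λ ()
... | ‵inject₁ j = λ eq → ℕₚ.1+n≢n (trans (cong toℕ eq) (Finₚ.toℕ-inject₁ j))

prev≢id : ∀ {k} (i : Fin (2 ℕ.+ k)) → prev i ≢ i
prev≢id i eq = next≢id (prev i) (trans (next-prev i) (sym eq))

next≢prev : ∀ {k} (i : Fin (3 ℕ.+ k)) → next i ≢ prev i
next≢prev i with view i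
... | ‵fromℕ           = λ ()
... | ‵inject₁ zero    = λ ()
... | ‵inject₁ (suc j) = λ eq → ℕₚ.<⇒≢ (ℕₚ.m<n⇒m<1+n (ℕₚ.n<1+n (toℕ j)))
                                 (sym (trans (cong toℕ eq) (trans (Finₚ.toℕ-inject₁ (inject₁ j)) (Finₚ.toℕ-inject₁ j))))

next²≢id : ∀ {k} (i : Fin (3 ℕ.+ k)) → next (next i) ≢ i
next²≢id i eq = next≢prev i (trans (sym (prev-next (next i))) (cong prev eq))

opposite-≤ : ∀ {n} {i j : Fin n} → i Fin.≤ j → opposite j Fin.≤ opposite i
opposite-≤ {n} {i} {j} i≤j = subst₂ ℕ._≤_ (sym (Finₚ.opposite-prop j)) (sym (Finₚ.opposite-prop i))
  (ℕₚ.∸-monoʳ-≤ n (s≤s i≤j))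

upward : ∀ {n} (P : Fin (suc n) → Set) {i} → P i →
  (∀ j → i Fin.≤ inject₁ j → P (inject₁ j) → P (suc j)) → ∀ {j} → i Fin.≤ j → P j
upward P {i} Pi step i≤j = <-weakInduction-startingFrom (λ j → i Fin.≤ j → P j) (λ _ → Pi) step′ i≤j i≤j
  where
  step′ : ∀ j → (i Fin.≤ inject₁ j → P (inject₁ j)) → i Fin.≤ suc j → P (suc j)
  step′ j IH i≤1+j with ℕₚ.m≤n⇒m<n∨m≡n i≤1+j
  ... | inj₁ i<1+j = step j i≤j′ (IH i≤j′)
    where i≤j′ = subst (toℕ i ℕ.≤_) (sym (Finₚ.toℕ-inject₁ j)) (ℕₚ.≤-pred i<1+j)
  ... | inj₂ i≡1+j = subst P (Finₚ.toℕ-injective i≡1+j) Pi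

-- The mirror image of upward under opposite, which exchanges inject₁ j and suc (opposite j).
downward : ∀ {n} (P : Fin (suc n) → Set) {i} → P i →
  (∀ j → suc j Fin.≤ i → P (suc j) → P (inject₁ j)) → ∀ {j} → j Fin.≤ i → P j
downward P {i} Pi step {j} j≤i = subst P (Finₚ.opposite-involutive j)
  (upward (P ∘ opposite) (subst P (sym (Finₚ.opposite-involutive i)) Pi) step′ (opposite-≤ j≤i))
  where
  step′ : ∀ k → opposite i Fin.≤ inject₁ k → P (opposite (inject₁ k)) → P (inject₁ (opposite k))
  step′ k oi≤k = step (opposite k) 1+ok≤i ∘ subst P (opposite-inject₁ k)
    where
    1+ok≤i : suc (opposite k) Fin.≤ i
    1+ok≤i = subst₂ Fin._≤_ (opposite-inject₁ k) (Finₚ.opposite-involutive i) (opposite-≤ oi≤k)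

<⇒≤prev : ∀ {m} {i j : Fin (suc m)} → i Fin.< j → i Fin.≤ prev j
<⇒≤prev {i = i} {suc j} i<j = subst (toℕ i ℕ.≤_) (sym (Finₚ.toℕ-inject₁ j)) (ℕₚ.≤-pred i<j)

prev<m : ∀ {m} {j : Fin (suc m)} → j ≢ zero → toℕ (prev j) ℕ.< m
prev<m {j = zero}  0≢0 = ⊥-elim (0≢0 refl)
prev<m {j = suc j} _   = Finₚ.inject₁ℕ< j

next≢zero : ∀ {m} {i : Fin (suc m)} → toℕ i ℕ.< m → next i ≢ zero
next≢zero {m} {i} i<m with view i
... | ‵fromℕ     = ⊥-elim (ℕₚ.<-irrefl (Finₚ.toℕ-fromℕ m) i<m)
... | ‵inject₁ j = λ ()

-- A model of L(W_{1,n}): spoke i is the edge from the hub to cycle vertex i, rim i the cycle edge {i, i+1}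

data Edge (m : ℕ) : Set where
  spoke rim : Fin (suc m) → Edge m

module _ {m : ℕ} where

  spoke-injective : ∀ {i j : Fin (suc m)} → spoke i ≡ spoke j → i ≡ j
  spoke-injective refl = refl

  rim-injective : ∀ {i j : Fin (suc m)} → rim i ≡ rim j → i ≡ j
  rim-injective refl = refl

  _≟ₑ_ : DecidableEquality (Edge m)
  spoke i ≟ₑ spoke j with i Finₚ.≟ j
  ... | yes refl = yes refl
  ... | no i≢j   = no (i≢j ∘ spoke-injective)
  spoke i ≟ₑ rim j   = no λ ()
  rim i   ≟ₑ spoke j = no λ ()
  rim i   ≟ₑ rim j with i Finₚ.≟ j
  ... | yes refl = yes refl
  ... | no i≢j   = no (i≢j ∘ rim-injective)

  data Meet : Edge m → Edge m → Set where
    ss : ∀ {i j} → i ≢ j → Meet (spoke i) (spoke j)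
    sr : ∀ {i j} → i ≡ j ⊎ i ≡ next j → Meet (spoke i) (rim j)
    rs : ∀ {i j} → j ≡ i ⊎ j ≡ next i → Meet (rim i) (spoke j)
    rr : ∀ {i j} → j ≡ next i ⊎ i ≡ next j → Meet (rim i) (rim j)

LineWheel : ℕ → Graph
LineWheel m = record { V = Edge m ; Adj = Meet }

next⇒cycAdj : ∀ {m} {i j : Fin (suc m)} → j ≡ next i ⊎ i ≡ next j → T (cycAdj (suc m) i j)
next⇒cycAdj {i = i} (inj₁ refl) = Equivalence.from Boolₚ.T-∨ (inj₁ (ℕₚ.≡⇒≡ᵇ _ _ (toℕ-next i)))
next⇒cycAdj {j = j} (inj₂ refl) = Equivalence.from Boolₚ.T-∨ (inj₂ (ℕₚ.≡⇒≡ᵇ _ _ (toℕ-next j)))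

cycAdj⇒next : ∀ {m} {i j : Fin (suc m)} → T (cycAdj (suc m) i j) → j ≡ next i ⊎ i ≡ next j
cycAdj⇒next {i = i} {j} adj = ⊎.map
  (λ t → Finₚ.toℕ-injective (trans (ℕₚ.≡ᵇ⇒≡ _ _ t) (sym (toℕ-next i))))
  (λ t → Finₚ.toℕ-injective (trans (ℕₚ.≡ᵇ⇒≡ _ _ t) (sym (toℕ-next j))))
  (Equivalence.to Boolₚ.T-∨ adj)

module _ {n : ℕ} where

  wheelEdge : {a b : Fin (suc n)} → a Fin.< b → T (wheelAdj n a b) → WheelEdge n
  wheelEdge {a} {b} a<b ab = (a , b) , Equivalence.from Boolₚ.T-∧ (fromWitness a<b , ab)

  WheelEdge-< : ∀ (e : WheelEdge n) → proj₁ (proj₁ e) Fin.< proj₂ (proj₁ e)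
  WheelEdge-< ((a , b) , t) = toWitness (proj₁ (Equivalence.to (Boolₚ.T-∧ {⌊ a Finₚ.<? b ⌋}) t))

  WheelEdge-adj : ∀ (e : WheelEdge n) → T (wheelAdj n (proj₁ (proj₁ e)) (proj₂ (proj₁ e)))
  WheelEdge-adj ((a , b) , t) = proj₂ (Equivalence.to (Boolₚ.T-∧ {⌊ a Finₚ.<? b ⌋}) t)

  WheelEdge-≡ : ∀ {a b c d t t′} → a ≡ c → b ≡ d → _≡_ {A = WheelEdge n} ((a , b) , t) ((c , d) , t′)
  WheelEdge-≡ {a} {b} {t = t} {t′} refl refl = cong ((a , b) ,_) (Boolₚ.T-irrelevant t t′)

module _ {k : ℕ} where
  private
    m : ℕ
    m = suc (suc k)

  toWheel : Edge m → WheelEdge (suc m)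
  toWheel (spoke i) = wheelEdge {a = zero} {b = suc i} (s≤s z≤n) _
  toWheel (rim i) with view i
  ... | ‵fromℕ     = wheelEdge {a = suc zero} {b = suc (fromℕ m)} (s≤s (s≤s z≤n))
                               (next⇒cycAdj {i = zero} {fromℕ m} (inj₂ (sym next-fromℕ)))
  ... | ‵inject₁ j = wheelEdge {a = suc (inject₁ j)} {b = suc (suc j)}
                               (s≤s (s≤s (ℕₚ.≤-reflexive (Finₚ.toℕ-inject₁ j))))
                               (next⇒cycAdj (inj₁ (sym (next-inject₁ j))))

  fromWheel : WheelEdge (suc m) → Edge m
  fromWheel ((zero  , suc j) , _) = spoke j
  fromWheel ((suc a , suc b) , _) with b Finₚ.≟ next a
  ... | yes _ = rim a
  ... | no _  = rim b
  -- junk: no wheel edge has the hub as its larger endpoint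
  fromWheel _ = spoke zero

  fromWheel∘toWheel : ∀ u → fromWheel (toWheel u) ≡ u
  fromWheel∘toWheel (spoke i) = refl
  fromWheel∘toWheel (rim i) with view i
  ... | ‵fromℕ with fromℕ m Finₚ.≟ next zero
  ...   | yes ()
  ...   | no _ = refl
  fromWheel∘toWheel (rim i) | ‵inject₁ j with suc j Finₚ.≟ next (inject₁ j)
  ...   | yes _   = refl
  ...   | no 1+j≢ = ⊥-elim (1+j≢ (sym (next-inject₁ j)))

  private
    toWheel-rim : ∀ {a b t} → b ≡ next a → toℕ a ℕ.< toℕ b → toWheel (rim a) ≡ ((suc a , suc b) , t)
    toWheel-rim {a} refl a<b with view a
    ... | ‵fromℕ     = ⊥-elim (ℕₚ.n≮0 a<b)
    ... | ‵inject₁ j = WheelEdge-≡ refl refl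

    toWheel-rim′ : ∀ {a b t} → a ≡ next b → toℕ a ℕ.< toℕ b → toWheel (rim b) ≡ ((suc a , suc b) , t)
    toWheel-rim′ {b = b} refl a<b with view b
    ... | ‵fromℕ     = WheelEdge-≡ refl refl
    ... | ‵inject₁ j = ⊥-elim (ℕₚ.<-asym a<b (subst (ℕ._< suc (toℕ j)) (sym (Finₚ.toℕ-inject₁ j)) (ℕₚ.n<1+n _)))

  toWheel∘fromWheel : ∀ e → toWheel (fromWheel e) ≡ e
  toWheel∘fromWheel e@((zero  , zero)  , _) = ⊥-elim (ℕₚ.<-irrefl refl (WheelEdge-< e))
  toWheel∘fromWheel   ((zero  , suc j) , _) = WheelEdge-≡ refl refl
  toWheel∘fromWheel e@((suc a , zero)  , _) = ⊥-elim (ℕₚ.n≮0 (WheelEdge-< e))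
  toWheel∘fromWheel e@((suc a , suc b) , _) with b Finₚ.≟ next a
  ... | yes b≡a+1 = toWheel-rim b≡a+1 (ℕₚ.≤-pred (WheelEdge-< e))
  ... | no b≢a+1  = toWheel-rim′ a≡b+1 (ℕₚ.≤-pred (WheelEdge-< e))
    where
    a≡b+1 : a ≡ next b
    a≡b+1 = ⊎.[ ⊥-elim ∘ b≢a+1 , (λ eq → eq) ] (cycAdj⇒next (WheelEdge-adj e))

  ends : Edge m → Fin (suc (suc m)) → Set
  ends (spoke i) z = z ≡ zero  ⊎ z ≡ suc i
  ends (rim i)   z = z ≡ suc i ⊎ z ≡ suc (next i)

  wheelEnds : WheelEdge (suc m) → Fin (suc (suc m)) → Set
  wheelEnds ((a , b) , _) z = z ≡ a ⊎ z ≡ b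

  ends⇒wheelEnds : ∀ u {z} → ends u z → wheelEnds (toWheel u) z
  ends⇒wheelEnds (spoke i) e = e
  ends⇒wheelEnds (rim i) e with view i
  ... | ‵fromℕ     = ⊎.swap e
  ... | ‵inject₁ j = e

  wheelEnds⇒ends : ∀ u {z} → wheelEnds (toWheel u) z → ends u z
  wheelEnds⇒ends (spoke i) e = e
  wheelEnds⇒ends (rim i) e with view i
  ... | ‵fromℕ     = ⊎.swap e
  ... | ‵inject₁ j = e

  shareEnd⇒common : ∀ e f → shareEnd e f → ∃[ z ] wheelEnds e z × wheelEnds f z
  shareEnd⇒common ((a , b) , _) _ (inj₁ refl)               = a , inj₁ refl , inj₁ refl
  shareEnd⇒common ((a , b) , _) _ (inj₂ (inj₁ refl))        = a , inj₁ refl , inj₂ refl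
  shareEnd⇒common ((a , b) , _) _ (inj₂ (inj₂ (inj₁ refl))) = b , inj₂ refl , inj₁ refl
  shareEnd⇒common ((a , b) , _) _ (inj₂ (inj₂ (inj₂ refl))) = b , inj₂ refl , inj₂ refl

  common⇒shareEnd : ∀ e f {z} → wheelEnds e z → wheelEnds f z → shareEnd e f
  common⇒shareEnd _ _ (inj₁ refl) (inj₁ refl) = inj₁ refl
  common⇒shareEnd _ _ (inj₁ refl) (inj₂ refl) = inj₂ (inj₁ refl)
  common⇒shareEnd _ _ (inj₂ refl) (inj₁ refl) = inj₂ (inj₂ (inj₁ refl))
  common⇒shareEnd _ _ (inj₂ refl) (inj₂ refl) = inj₂ (inj₂ (inj₂ refl))

  Meet-irrefl : ∀ {u} → ¬ Meet u u
  Meet-irrefl (ss i≢i)     = i≢i refl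
  Meet-irrefl (rr (inj₁ e)) = next≢id {suc k} _ (sym e)
  Meet-irrefl (rr (inj₂ e)) = next≢id {suc k} _ (sym e)

  Meet⇒common : ∀ {u v} → Meet u v → ∃[ z ] ends u z × ends v z
  Meet⇒common (ss _)                   = zero , inj₁ refl , inj₁ refl
  Meet⇒common (sr {i} (inj₁ refl))     = suc i , inj₂ refl , inj₁ refl
  Meet⇒common (sr {i} (inj₂ refl))     = suc i , inj₂ refl , inj₂ refl
  Meet⇒common (rs {i} (inj₁ refl))     = suc i , inj₁ refl , inj₂ refl
  Meet⇒common (rs {i} (inj₂ refl))     = suc (next i) , inj₂ refl , inj₂ refl
  Meet⇒common (rr {i} (inj₁ refl))     = suc (next i) , inj₂ refl , inj₁ refl
  Meet⇒common (rr {j = j} (inj₂ refl)) = suc (next j) , inj₁ refl , inj₂ refl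

  common⇒Meet : ∀ {u v z} → u ≢ v → ends u z → ends v z → Meet u v
  common⇒Meet {spoke i} {spoke j} u≢v _ _ = ss (u≢v ∘ cong spoke)
  common⇒Meet {spoke i} {rim j} _ (inj₁ refl) (inj₁ ())
  common⇒Meet {spoke i} {rim j} _ (inj₁ refl) (inj₂ ())
  common⇒Meet {spoke i} {rim j} _ (inj₂ refl) e = sr (⊎.map Finₚ.suc-injective Finₚ.suc-injective e)
  common⇒Meet {rim i} {spoke j} _ e (inj₁ refl) = ⊎.[ (λ ()) , (λ ()) ] e
  common⇒Meet {rim i} {spoke j} _ e (inj₂ refl) = rs (⊎.map Finₚ.suc-injective Finₚ.suc-injective e)
  common⇒Meet {rim i} {rim j} u≢v (inj₁ refl) (inj₁ e) = ⊥-elim (u≢v (cong rim (Finₚ.suc-injective e)))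
  common⇒Meet {rim i} {rim j} _   (inj₁ refl) (inj₂ e) = rr (inj₂ (Finₚ.suc-injective e))
  common⇒Meet {rim i} {rim j} _   (inj₂ refl) (inj₁ e) = rr (inj₁ (sym (Finₚ.suc-injective e)))
  common⇒Meet {rim i} {rim j} u≢v (inj₂ refl) (inj₂ e) =
    ⊥-elim (u≢v (cong rim (next-injective {m} (Finₚ.suc-injective e))))

  toWheel-injective : ∀ {u v} → toWheel u ≡ toWheel v → u ≡ v
  toWheel-injective {u} {v} eq = trans (sym (fromWheel∘toWheel u)) (trans (cong fromWheel eq) (fromWheel∘toWheel v))

  fromWheel-injective : ∀ {e f} → fromWheel e ≡ fromWheel f → e ≡ f
  fromWheel-injective {e} {f} eq = trans (sym (toWheel∘fromWheel e)) (trans (cong toWheel eq) (toWheel∘fromWheel f))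

  toWheel-adj : ∀ {u v} → Meet u v → Adj (LW (suc m)) (toWheel u) (toWheel v)
  toWheel-adj {u} {v} u~v with Meet⇒common u~v
  ... | z , zu , zv = (λ eq → Meet-irrefl (subst (Meet u) (sym (toWheel-injective eq)) u~v))
                    , common⇒shareEnd (toWheel u) (toWheel v) (ends⇒wheelEnds u zu) (ends⇒wheelEnds v zv)

  fromWheel-adj : ∀ {e f} → Adj (LW (suc m)) e f → Meet (fromWheel e) (fromWheel f)
  fromWheel-adj {e} {f} (e≢f , share) with shareEnd⇒common e f share
  ... | z , ze , zf = common⇒Meet (e≢f ∘ fromWheel-injective) (ends-fromWheel e ze) (ends-fromWheel f zf)
    where
    ends-fromWheel : ∀ e {z} → wheelEnds e z → ends (fromWheel e) z
    ends-fromWheel e {z} = wheelEnds⇒ends (fromWheel e) ∘ subst (λ x → wheelEnds x z) (sym (toWheel∘fromWheel e))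

  LineWheel≅LW : LineWheel m ≅ LW (suc m)
  LineWheel≅LW = record
    { to = toWheel ; from = fromWheel ; from∘to = fromWheel∘toWheel ; to∘from = toWheel∘fromWheel
    ; to-adj = toWheel-adj ; from-adj = fromWheel-adj }

module _ {m : ℕ} where

  relabel : (Fin (suc m) → Fin (suc m)) → Edge m → Edge m
  relabel π (spoke i) = spoke (π i)
  relabel π (rim i)   = rim (π i)

  relabel-Meet : ∀ {π} → (∀ {i j} → π i ≡ π j → i ≡ j) → (∀ i → π (next i) ≡ next (π i)) →
    ∀ {u v} → Meet u v → Meet (relabel π u) (relabel π v)
  relabel-Meet π-inj π-next (ss i≢j)              = ss (i≢j ∘ π-inj)
  relabel-Meet π-inj π-next (sr (inj₁ refl))      = sr (inj₁ refl)
  relabel-Meet π-inj π-next (sr {j = j} (inj₂ refl)) = sr (inj₂ (π-next j))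
  relabel-Meet π-inj π-next (rs (inj₁ refl))      = rs (inj₁ refl)
  relabel-Meet π-inj π-next (rs {i} (inj₂ refl))  = rs (inj₂ (π-next i))
  relabel-Meet π-inj π-next (rr {i} (inj₁ refl))  = rr (inj₁ (π-next i))
  relabel-Meet π-inj π-next (rr {j = j} (inj₂ refl)) = rr (inj₂ (π-next j))

  rotation : LineWheel m ≅ LineWheel m
  rotation = record
    { to = relabel prev ; from = relabel next
    ; from∘to = λ { (spoke i) → cong spoke (next-prev i) ; (rim i) → cong rim (next-prev i) }
    ; to∘from = λ { (spoke i) → cong spoke (prev-next i) ; (rim i) → cong rim (prev-next i) }
    ; to-adj   = relabel-Meet prev-injective (λ i → trans (prev-next i) (sym (next-prev i)))
    ; from-adj = relabel-Meet next-injective (λ _ → refl) }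

  prevⁿ : ℕ → Fin (suc m) → Fin (suc m)
  prevⁿ zero    i = i
  prevⁿ (suc a) i = prevⁿ a (prev i)

  rotation^ : ℕ → LineWheel m ≅ LineWheel m
  rotation^ zero    = ≅-refl
  rotation^ (suc a) = ≅-trans rotation (rotation^ a)

  rotation^-relabel : ∀ a u → to (rotation^ a) u ≡ relabel (prevⁿ a) u
  rotation^-relabel zero    (spoke i) = refl
  rotation^-relabel zero    (rim i)   = refl
  rotation^-relabel (suc a) (spoke i) = rotation^-relabel a (spoke (prev i))
  rotation^-relabel (suc a) (rim i)   = rotation^-relabel a (rim (prev i))

  prevⁿ-next : ∀ a i → prevⁿ a (next i) ≡ next (prevⁿ a i)
  prevⁿ-next zero    i = refl
  prevⁿ-next (suc a) i = trans (cong (prevⁿ a) (trans (prev-next i) (sym (next-prev i))))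
                               (prevⁿ-next a (prev i))

  prevⁿ-injective : ∀ a {i j} → prevⁿ a i ≡ prevⁿ a j → i ≡ j
  prevⁿ-injective zero    eq = eq
  prevⁿ-injective (suc a) eq = prev-injective (prevⁿ-injective a eq)

prevⁿ-toℕ : ∀ {m} (i : Fin (suc m)) → prevⁿ (toℕ i) i ≡ zero
prevⁿ-toℕ i = go (toℕ i) i refl
  where
  go : ∀ {m} a (i : Fin (suc m)) → toℕ i ≡ a → prevⁿ a i ≡ zero
  go zero    zero    _  = refl
  go (suc a) (suc i) eq = go a (inject₁ i) (trans (Finₚ.toℕ-inject₁ i) (ℕₚ.suc-injective eq))

module _ {m : ℕ} where

  -- opposite i = m − i reflects the cycle and sends the rim {i, i+1} to {m−i−1, m−i}.
  reflectₑ : Edge m → Edge m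
  reflectₑ (spoke i) = spoke (opposite i)
  reflectₑ (rim i)   = rim (opposite (next i))

  reflectₑ-involutive : ∀ u → reflectₑ (reflectₑ u) ≡ u
  reflectₑ-involutive (spoke i) = cong spoke (Finₚ.opposite-involutive i)
  reflectₑ-involutive (rim i)   = cong rim (begin
    opposite (next (opposite (next i))) ≡⟨ cong opposite (next-opposite (next i)) ⟩
    opposite (opposite (prev (next i))) ≡⟨ Finₚ.opposite-involutive _ ⟩
    prev (next i)                       ≡⟨ prev-next i ⟩
    i                                   ∎)
    where open ≡-Reasoning

  reflectₑ-Meet : ∀ {u v} → Meet u v → Meet (reflectₑ u) (reflectₑ v)
  reflectₑ-Meet (ss i≢j)                 = ss (i≢j ∘ opposite-injective)
    where
    opposite-injective : ∀ {i j : Fin (suc m)} → opposite i ≡ opposite j → i ≡ j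
    opposite-injective {i} {j} eq = trans (sym (Finₚ.opposite-involutive i))
                                          (trans (cong opposite eq) (Finₚ.opposite-involutive j))
  reflectₑ-Meet (sr {j = j} (inj₁ refl)) = sr (inj₂ (opposite-next-next j))
  reflectₑ-Meet (sr (inj₂ refl))         = sr (inj₁ refl)
  reflectₑ-Meet (rs {i} (inj₁ refl))     = rs (inj₂ (opposite-next-next i))
  reflectₑ-Meet (rs (inj₂ refl))         = rs (inj₁ refl)
  reflectₑ-Meet (rr {i} (inj₁ refl))     = rr (inj₂ (opposite-next-next (next i)))
  reflectₑ-Meet (rr {j = j} (inj₂ refl)) = rr (inj₁ (opposite-next-next (next j)))

  reflection : LineWheel m ≅ LineWheel m
  reflection = record
    { to = reflectₑ ; from = reflectₑ ; from∘to = reflectₑ-involutive ; to∘from = reflectₑ-involutive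
    ; to-adj = reflectₑ-Meet ; from-adj = reflectₑ-Meet }

δ : ∀ {n} → Fin n → Fin n → ℤ
δ i j with i Finₚ.≟ j
... | yes _ = 1ℤ
... | no _  = 0ℤ

module _ {n : ℕ} where

  δ-refl : ∀ (i : Fin n) → δ i i ≡ 1ℤ
  δ-refl i with i Finₚ.≟ i
  ... | yes _  = refl
  ... | no i≢i = ⊥-elim (i≢i refl)

  δ-≢ : ∀ {i j : Fin n} → i ≢ j → δ i j ≡ 0ℤ
  δ-≢ {i} {j} i≢j with i Finₚ.≟ j
  ... | yes i≡j = ⊥-elim (i≢j i≡j)
  ... | no _    = refl

  δ-≡ : ∀ {i j : Fin n} → i ≡ j → δ i j ≡ 1ℤ
  δ-≡ refl = δ-refl _

  δ-≢′ : ∀ {i j : Fin n} → j ≢ i → δ i j ≡ 0ℤ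
  δ-≢′ j≢i = δ-≢ (j≢i ∘ sym)

  δ-cong : ∀ {i j k l : Fin n} → (i ≡ j → k ≡ l) → (k ≡ l → i ≡ j) → δ i j ≡ δ k l
  δ-cong {i} {j} {k} {l} to from with i Finₚ.≟ j | k Finₚ.≟ l
  ... | yes _   | yes _   = refl
  ... | no _    | no _    = refl
  ... | yes i≡j | no k≢l  = ⊥-elim (k≢l (to i≡j))
  ... | no i≢j  | yes k≡l = ⊥-elim (i≢j (from k≡l))

  sum-zero : ∀ (f : Fin n → ℤ) → (∀ i → f i ≡ 0ℤ) → sum f ≡ 0ℤ
  sum-zero f f≡0 = trans (sum-cong-≗ f≡0) (sum-replicate-zero n)

sum-single : ∀ {n} (a : Fin n) (f : Fin n → ℤ) → (∀ i → i ≢ a → f i ≡ 0ℤ) → sum f ≡ f a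
sum-single zero    f f≡0 = trans (cong (_+_ (f zero)) (sum-zero (f ∘ suc) (λ i → f≡0 (suc i) λ ())))
                                 (ℤₚ.+-identityʳ (f zero))
sum-single (suc a) f f≡0 = trans
  (cong₂ _+_ (f≡0 zero λ ()) (sum-single a (f ∘ suc) (λ i i≢a → f≡0 (suc i) (i≢a ∘ Finₚ.suc-injective))))
  (ℤₚ.+-identityˡ (f (suc a)))

sum-δ : ∀ {n} (a : Fin n) (f : Fin n → ℤ) → sum (λ j → f j * δ j a) ≡ f a
sum-δ a f = trans (sum-single a _ (λ i i≢a → trans (cong (f i *_) (δ-≢ i≢a)) (ℤₚ.*-zeroʳ (f i))))
                  (trans (cong (f a *_) (δ-refl a)) (ℤₚ.*-identityʳ (f a)))

sum-δ₁ : ∀ {n} (a : Fin n) → sum (λ j → δ j a) ≡ 1ℤ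
sum-δ₁ a = trans (sum-cong-≗ (λ j → sym (ℤₚ.*-identityˡ (δ j a)))) (sum-δ a (λ _ → 1ℤ))

sum-cδ : ∀ {n} c (a : Fin n) → sum (λ j → c * δ j a) ≡ c
sum-cδ c a = trans (sym (*-distribˡ-sum c (λ j → δ j a))) (trans (cong (c *_) (sum-δ₁ a)) (ℤₚ.*-identityʳ c))

sum-δ₂ : ∀ {n} c d (a b : Fin n) → sum (λ j → c * δ j a + d * δ j b) ≡ c + d
sum-δ₂ c d a b = trans (∑-distrib-+ (λ j → c * δ j a) (λ j → d * δ j b)) (cong₂ _+_ (sum-cδ c a) (sum-cδ d b))

≢0-via : ∀ {a b : ℤ} → a ≡ b → b ≢ 0ℤ → a ≢ 0ℤ
≢0-via a≡b b≢0 a≡0 = b≢0 (trans (sym a≡b) a≡0)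

sum-const : ∀ {n} (c : ℤ) → sum {n} (λ _ → c) ≡ + n * c
sum-const {zero}  c = sym (ℤₚ.*-zeroˡ c)
sum-const {suc n} c = trans (cong (_+_ c) (sum-const {n} c)) (lemma c (+ n))
  where
  lemma : ∀ c k → c + k * c ≡ (1ℤ + k) * c
  lemma = solve-∀

pick₁ : ∀ x y {a b} → a ≡ 1ℤ → b ≡ 0ℤ → x * a + y * b ≡ x
pick₁ x y refl refl = lemma x y
  where lemma : ∀ x y → x * 1ℤ + y * 0ℤ ≡ x
        lemma = solve-∀

pick₂ : ∀ x y {a b} → a ≡ 0ℤ → b ≡ 1ℤ → x * a + y * b ≡ y
pick₂ x y refl refl = lemma x y
  where lemma : ∀ x y → x * 0ℤ + y * 1ℤ ≡ y
        lemma = solve-∀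

none₂ : ∀ x y {a b} → a ≡ 0ℤ → b ≡ 0ℤ → x * a + y * b ≡ 0ℤ
none₂ x y refl refl = lemma x y
  where lemma : ∀ x y → x * 0ℤ + y * 0ℤ ≡ 0ℤ
        lemma = solve-∀

pick₃₁ : ∀ x y z {a b c} → a ≡ 1ℤ → b ≡ 0ℤ → c ≡ 0ℤ → x * a + y * b + z * c ≡ x
pick₃₁ x y z refl refl refl = lemma x y z
  where lemma : ∀ x y z → x * 1ℤ + y * 0ℤ + z * 0ℤ ≡ x
        lemma = solve-∀

pick₃₂ : ∀ x y z {a b c} → a ≡ 0ℤ → b ≡ 1ℤ → c ≡ 0ℤ → x * a + y * b + z * c ≡ y
pick₃₂ x y z refl refl refl = lemma x y z
  where lemma : ∀ x y z → x * 0ℤ + y * 1ℤ + z * 0ℤ ≡ y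
        lemma = solve-∀

none₃ : ∀ x y z {a b c} → a ≡ 0ℤ → b ≡ 0ℤ → c ≡ 0ℤ → x * a + y * b + z * c ≡ 0ℤ
none₃ x y z refl refl refl = lemma x y z
  where lemma : ∀ x y z → x * 0ℤ + y * 0ℤ + z * 0ℤ ≡ 0ℤ
        lemma = solve-∀

module _ {m : ℕ} where

  δ-next-prev : ∀ (t i : Fin (suc m)) → δ (next t) i ≡ δ t (prev i)
  δ-next-prev t i = δ-cong (λ e → trans (sym (prev-next t)) (cong prev e)) (λ e → trans (cong next e) (next-prev i))

  δ-next-next : ∀ (t i : Fin (suc m)) → δ (next t) (next i) ≡ δ t i
  δ-next-next t i = δ-cong next-injective (cong next)

-- Lower bound via null vectors of LineWheel m − e

module _ {m : ℕ} where

  ∑ₑ : (Edge m → ℤ) → ℤ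
  ∑ₑ f = sum (f ∘ spoke) + sum (f ∘ rim)

  ∑ₑ-single : ∀ w f → (∀ v → v ≢ w → f v ≡ 0ℤ) → ∑ₑ f ≡ f w
  ∑ₑ-single (spoke a) f f≡0 = trans
    (cong₂ _+_ (sum-single a (f ∘ spoke) (λ i i≢a → f≡0 (spoke i) (i≢a ∘ spoke-injective)))
               (sum-zero (f ∘ rim) (λ i → f≡0 (rim i) λ ())))
    (ℤₚ.+-identityʳ (f (spoke a)))
  ∑ₑ-single (rim a) f f≡0 = trans
    (cong₂ _+_ (sum-zero (f ∘ spoke) (λ i → f≡0 (spoke i) λ ()))
               (sum-single a (f ∘ rim) (λ i i≢a → f≡0 (rim i) (i≢a ∘ rim-injective))))
    (ℤₚ.+-identityˡ (f (rim a)))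

  ∑ₑ-comm : ∀ {k} (f : Edge m → Fin k → ℤ) → ∑ₑ (λ v → sum (f v)) ≡ sum (λ t → ∑ₑ (λ v → f v t))
  ∑ₑ-comm f = trans (cong₂ _+_ (∑-comm (f ∘ spoke)) (∑-comm (f ∘ rim)))
                    (sym (∑-distrib-+ (λ t → sum (λ i → f (spoke i) t)) (λ t → sum (λ i → f (rim i) t))))

  *-distribˡ-∑ₑ : ∀ c f → c * ∑ₑ f ≡ ∑ₑ (λ v → c * f v)
  *-distribˡ-∑ₑ c f = trans (ℤₚ.*-distribˡ-+ c (sum (f ∘ spoke)) (sum (f ∘ rim)))
                            (cong₂ _+_ (*-distribˡ-sum c (f ∘ spoke)) (*-distribˡ-sum c (f ∘ rim)))

  spokeSum : (Edge m → ℤ) → ℤ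
  spokeSum a = sum (a ∘ spoke)

  nullVec : (Fin (suc m) → ℤ) → Fin (suc m) → Edge m → ℤ
  nullVec Γ t (spoke j) = δ j t - δ j (next t) + Γ t
  nullVec Γ t (rim j)   = δ j t

  rowValue : (Fin (suc m) → ℤ) → (Edge m → ℤ) → Fin (suc m) → ℤ
  rowValue Γ a t = a (spoke t) - a (spoke (next t)) + a (rim t) + Γ t * spokeSum a

  row·nullVec : ∀ Γ a t → ∑ₑ (λ v → a v * nullVec Γ t v) ≡ rowValue Γ a t
  row·nullVec Γ a t = begin
    sum (λ j → a (spoke j) * (δ j t - δ j (next t) + Γ t)) + sum (λ j → a (rim j) * δ j t)
      ≡⟨ cong₂ _+_ (sum-cong-≗ (λ j → expand (a (spoke j)) (δ j t) (δ j (next t)) (Γ t))) (sum-δ t (a ∘ rim)) ⟩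
    sum (λ j → a (spoke j) * δ j t + -1ℤ * (a (spoke j) * δ j (next t)) + Γ t * a (spoke j)) + a (rim t)
      ≡⟨ cong (_+ a (rim t)) (trans (∑-distrib-+ (λ j → a (spoke j) * δ j t + -1ℤ * (a (spoke j) * δ j (next t)))
                                             (λ j → Γ t * a (spoke j)))
                                (cong (_+ sum (λ j → Γ t * a (spoke j)))
                                      (∑-distrib-+ (λ j → a (spoke j) * δ j t)
                                                   (λ j → -1ℤ * (a (spoke j) * δ j (next t)))))) ⟩
    sum (λ j → a (spoke j) * δ j t) + sum (λ j → -1ℤ * (a (spoke j) * δ j (next t)))
      + sum (λ j → Γ t * a (spoke j)) + a (rim t)
      ≡⟨ cong (_+ a (rim t)) (cong₂ _+_
           (cong₂ _+_ (sum-δ t (a ∘ spoke))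
                      (trans (sym (*-distribˡ-sum -1ℤ (λ j → a (spoke j) * δ j (next t))))
                             (cong (-1ℤ *_) (sum-δ (next t) (a ∘ spoke)))))
           (sym (*-distribˡ-sum (Γ t) (a ∘ spoke)))) ⟩
    a (spoke t) + -1ℤ * a (spoke (next t)) + Γ t * spokeSum a + a (rim t)
      ≡⟨ rearrange (a (spoke t)) (a (spoke (next t))) (Γ t * spokeSum a) (a (rim t)) ⟩
    rowValue Γ a t ∎
    where
    open ≡-Reasoning
    expand : ∀ a p q g → a * (p - q + g) ≡ a * p + -1ℤ * (a * q) + g * a
    expand = solve-∀
    rearrange : ∀ p q r s → p + -1ℤ * q + r + s ≡ p - q + s + r
    rearrange = solve-∀

  -- A matrix with the off-diagonal pattern of LineWheel m − xy whose rows all satisfy rowValue Γ ≡ 0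
  -- has the null vectors nullVec Γ t, which are independent since their rim coordinates are δ · t.
  record Nullity (x y : Edge m) : Set where
    field
      A         : Edge m → Edge m → ℤ
      Γ         : Fin (suc m) → ℤ
      A-adj     : ∀ {u v} → Adj (deleteEdge (LineWheel m) x y) u v → A u v ≢ 0ℤ
      A-support : ∀ {u v} → u ≢ v → A u v ≢ 0ℤ → Adj (deleteEdge (LineWheel m) x y) u v
      A-rows    : ∀ u t → rowValue Γ (A u) t ≡ 0ℤ

  Nullity⇒bound : ∀ {x y} → Nullity x y → ∀ S → IsZFS (deleteEdge (LineWheel m) x y) S → suc m ℕ.≤ length S
  Nullity⇒bound {x} {y} N S zfs with suc m ℕ.≤? length S
  ... | yes n≤|S| = n≤|S|
  ... | no  n≰|S| = ⊥-elim (l-i≢0 (trans (sym (w-rim i)) (vanishes (zfs (rim i)))))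
    where
    open Nullity N
    open NullVector (deleteEdge (LineWheel m) x y) _≟ₑ_ ∑ₑ ∑ₑ-single A A-adj A-support
    vecs : Edge m → Fin (suc m) → ℤ
    vecs v t = nullVec Γ t v
    solution = nontrivial-solution (suc m) (map vecs S)
      (subst (ℕ._< suc m) (sym (Listₚ.length-map vecs S)) (ℕₚ.≰⇒> n≰|S|))
    l = proj₁ solution
    i = proj₁ (proj₁ (proj₂ solution))
    l-i≢0 = proj₂ (proj₁ (proj₂ solution))
    w : Edge m → ℤ
    w v = vecs v · l
    w-rim : ∀ s → w (rim s) ≡ l s
    w-rim s = trans (sum-cong-≗ λ t → trans (cong (_* l t) (δ-cong {i = s} {t} sym sym)) (ℤₚ.*-comm (δ t s) (l t)))
                    (sum-δ s l)
    Aw≡0 : ∀ u → ∑ₑ (λ v → A u v * w v) ≡ 0ℤ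
    Aw≡0 u = begin
      ∑ₑ (λ v → A u v * w v)
        ≡⟨ cong₂ _+_ (sum-cong-≗ (λ j → distribute (spoke j))) (sum-cong-≗ (λ j → distribute (rim j))) ⟩
      ∑ₑ (λ v → sum (λ t → l t * (A u v * nullVec Γ t v)))
        ≡⟨ ∑ₑ-comm (λ v t → l t * (A u v * nullVec Γ t v)) ⟩
      sum (λ t → ∑ₑ (λ v → l t * (A u v * nullVec Γ t v)))
        ≡⟨ sum-cong-≗ (λ t → sym (*-distribˡ-∑ₑ (l t) (λ v → A u v * nullVec Γ t v))) ⟩
      sum (λ t → l t * ∑ₑ (λ v → A u v * nullVec Γ t v))
        ≡⟨ sum-zero (λ t → l t * ∑ₑ (λ v → A u v * nullVec Γ t v))
                    (λ t → trans (cong (l t *_) (trans (row·nullVec Γ (A u) t) (A-rows u t))) (ℤₚ.*-zeroʳ (l t))) ⟩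
      0ℤ ∎
      where
      open ≡-Reasoning
      distribute : ∀ v → A u v * w v ≡ sum (λ t → l t * (A u v * nullVec Γ t v))
      distribute v = trans (*-distribˡ-sum (A u v) (λ t → vecs v t * l t))
                           (sum-cong-≗ (λ t → reorder (A u v) (vecs v t) (l t)))
        where
        reorder : ∀ a b c → a * (b * c) ≡ c * (a * b)
        reorder = solve-∀
    vanishes : ∀ {v} → Black (deleteEdge (LineWheel m) x y) S v → w v ≡ 0ℤ
    vanishes = null-vanishes-on-Black w Aw≡0 (λ v∈S → proj₂ (proj₂ solution) (∈ₚ.∈-map⁺ vecs v∈S))

  Z-determined : ∀ {x y} → Nullity x y → ∀ S → Unique S → length S ≡ suc m →
    IsZFS (deleteEdge (LineWheel m) x y) S → ZeroForcingNumberIs (deleteEdge (LineWheel m) x y) (suc m)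
  Z-determined N S unique |S|≡n zfs = (S , unique , |S|≡n , zfs) , λ S′ _ zfs′ → Nullity⇒bound N S′ zfs′

-- Rows of the matrices away from the deleted edge

module StandardRows {k : ℕ} where
  m : ℕ
  m = suc (suc k)

  N : ℤ
  N = + suc m

  sum-affine : ∀ c d (a : Fin (suc m)) → sum (λ j → c + d * δ j a) ≡ N * c + d
  sum-affine c d a = trans (∑-distrib-+ (λ _ → c) (λ j → d * δ j a))
    (cong₂ _+_ (sum-const {suc m} c) (sum-cδ d a))

  sum-affine₂ : ∀ c d e (a b : Fin (suc m)) → sum (λ j → c + d * δ j a + e * δ j b) ≡ N * c + d + e
  sum-affine₂ c d e a b = trans (∑-distrib-+ (λ j → c + d * δ j a) (λ j → e * δ j b))
    (cong₂ _+_ (sum-affine c d a) (sum-cδ e b))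

  -- Both rows satisfy rowValue Γ ≡ 0 for every Γ since their spoke sums vanish.
  spokeRow : Fin (suc m) → Edge m → ℤ
  spokeRow i (spoke j) = 1ℤ + - N * δ j i
  spokeRow i (rim j)   = N * δ j i + - N * δ j (prev i)

  rimRow : Fin (suc m) → Edge m → ℤ
  rimRow i (spoke j) = 1ℤ * δ j i + -1ℤ * δ j (next i)
  rimRow i (rim j)   = 1ℤ * δ j (prev i) + 1ℤ * δ j (next i) + - + 2 * δ j i

  rowValue-zero : ∀ Γ a t → a (spoke t) - a (spoke (next t)) + a (rim t) ≡ 0ℤ → spokeSum a ≡ 0ℤ →
                  rowValue {m} Γ a t ≡ 0ℤ
  rowValue-zero Γ a t value≡0 sum≡0 = cong₂ _+_ value≡0 (trans (cong (Γ t *_) sum≡0) (ℤₚ.*-zeroʳ (Γ t)))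

  spokeRow-kills : ∀ i Γ t → rowValue Γ (spokeRow i) t ≡ 0ℤ
  spokeRow-kills i Γ t = rowValue-zero Γ (spokeRow i) t
    (trans (cong (λ d → 1ℤ + - N * δ t i - (1ℤ + - N * d) + (N * δ t i + - N * δ t (prev i))) (δ-next-prev t i))
           (cancel N (δ t i) (δ t (prev i))))
    (trans (sum-affine 1ℤ (- N) i) (cancel′ N))
    where
    cancel : ∀ N a b → 1ℤ + - N * a - (1ℤ + - N * b) + (N * a + - N * b) ≡ 0ℤ
    cancel = solve-∀
    cancel′ : ∀ N → N * 1ℤ + - N ≡ 0ℤ
    cancel′ = solve-∀

  rimRow-kills : ∀ i Γ t → rowValue Γ (rimRow i) t ≡ 0ℤ
  rimRow-kills i Γ t = rowValue-zero Γ (rimRow i) t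
    (trans (cong₂ (λ d e → 1ℤ * δ t i + -1ℤ * δ t (next i) - (1ℤ * d + -1ℤ * e)
                             + (1ℤ * δ t (prev i) + 1ℤ * δ t (next i) + - + 2 * δ t i))
                  (δ-next-prev t i) (δ-next-next t i))
           (cancel (δ t i) (δ t (next i)) (δ t (prev i))))
    (sum-δ₂ 1ℤ -1ℤ i (next i))
    where
    cancel : ∀ a b c → 1ℤ * a + -1ℤ * b - (1ℤ * c + -1ℤ * a) + (1ℤ * c + 1ℤ * b + - + 2 * a) ≡ 0ℤ
    cancel = solve-∀

  spokeRow-adj : ∀ i {v} → Meet (spoke i) v → spokeRow i v ≢ 0ℤ
  spokeRow-adj i (ss {j = j} i≢j) = ≢0-via (trans (cong (λ d → 1ℤ + - N * d) (δ-≢′ i≢j)) (lemma N)) λ ()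
    where lemma : ∀ N → 1ℤ + - N * 0ℤ ≡ 1ℤ
          lemma = solve-∀
  spokeRow-adj i (sr (inj₁ refl)) = ≢0-via (pick₁ N (- N) (δ-refl i) (δ-≢′ (prev≢id {suc k} i))) λ ()
  spokeRow-adj _ (sr {j = j} (inj₂ refl)) =
    ≢0-via (pick₂ N (- N) (δ-≢′ (next≢id {suc k} j)) (δ-≡ (sym (prev-next j)))) λ ()

  spokeRow-support : ∀ i v → spoke i ≢ v → spokeRow i v ≢ 0ℤ → Meet (spoke i) v
  spokeRow-support i (spoke j) i≢j _ = ss (i≢j ∘ cong spoke)
  spokeRow-support i (rim j) _ ≢0 = decide (j Finₚ.≟ i) (j Finₚ.≟ prev i)
    where
    decide : Dec (j ≡ i) → Dec (j ≡ prev i) → Meet (spoke i) (rim j)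
    decide (yes j≡i) _         = sr (inj₁ (sym j≡i))
    decide (no _)   (yes j≡i-1) = sr (inj₂ (trans (sym (next-prev i)) (cong next (sym j≡i-1))))
    decide (no j≢i) (no j≢i-1)  = ⊥-elim (≢0 (none₂ N (- N) (δ-≢ j≢i) (δ-≢ j≢i-1)))

  rimRow-adj : ∀ i {v} → Meet (rim i) v → rimRow i v ≢ 0ℤ
  rimRow-adj i (rs (inj₁ refl)) = ≢0-via (pick₁ 1ℤ -1ℤ (δ-refl i) (δ-≢′ (next≢id {suc k} i))) λ ()
  rimRow-adj i (rs (inj₂ refl)) = ≢0-via (pick₂ 1ℤ -1ℤ (δ-≢ (next≢id {suc k} i)) (δ-refl (next i))) λ ()
  rimRow-adj i (rr (inj₁ refl)) =
    ≢0-via (pick₃₂ 1ℤ 1ℤ (- + 2) (δ-≢ (next≢prev {k} i)) (δ-refl (next i)) (δ-≢ (next≢id {suc k} i))) λ ()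
  rimRow-adj _ (rr {j = j} (inj₂ refl)) =
    ≢0-via (pick₃₁ 1ℤ 1ℤ (- + 2) (δ-≡ (sym (prev-next j))) (δ-≢′ (next²≢id {k} j)) (δ-≢′ (next≢id {suc k} j)))
           λ ()

  rimRow-support : ∀ i v → rim i ≢ v → rimRow i v ≢ 0ℤ → Meet (rim i) v
  rimRow-support i (spoke j) _ ≢0 = decide (j Finₚ.≟ i) (j Finₚ.≟ next i)
    where
    decide : Dec (j ≡ i) → Dec (j ≡ next i) → Meet (rim i) (spoke j)
    decide (yes j≡i) _          = rs (inj₁ j≡i)
    decide (no _)    (yes j≡i+1) = rs (inj₂ j≡i+1)
    decide (no j≢i)  (no j≢i+1)  = ⊥-elim (≢0 (none₂ 1ℤ -1ℤ (δ-≢ j≢i) (δ-≢ j≢i+1)))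
  rimRow-support i (rim j) i≢j ≢0 = decide (j Finₚ.≟ prev i) (j Finₚ.≟ next i)
    where
    decide : Dec (j ≡ prev i) → Dec (j ≡ next i) → Meet (rim i) (rim j)
    decide (yes j≡i-1) _          = rr (inj₂ (trans (sym (next-prev i)) (cong next (sym j≡i-1))))
    decide (no _)      (yes j≡i+1) = rr (inj₁ j≡i+1)
    decide (no j≢i-1)  (no j≢i+1)  =
      ⊥-elim (≢0 (none₃ 1ℤ 1ℤ (- + 2) (δ-≢ j≢i-1) (δ-≢ j≢i+1) (δ-≢ (i≢j ∘ cong rim ∘ sym))))

-- Deleting the edge spoke 0 — rim 0

module SpokeRim {k : ℕ} where
  open StandardRows {k}

  z p0 n0 : Fin (suc m)
  z  = zero
  p0 = prev z
  n0 = next z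

  H : Graph
  H = deleteEdge (LineWheel m) (spoke z) (rim z)

  spokeRow₀ : Edge m → ℤ
  spokeRow₀ (spoke j) = 1ℤ
  spokeRow₀ (rim j)   = - N * δ j p0

  rimRow₀ : Edge m → ℤ
  rimRow₀ (spoke j) = 1ℤ * δ j n0
  rimRow₀ (rim j)   = -1ℤ * δ j p0 + -1ℤ * δ j n0 + 1ℤ * δ j z

  A : Edge m → Edge m → ℤ
  A (spoke zero)    = spokeRow₀
  A (spoke (suc i)) = spokeRow (suc i)
  A (rim zero)      = rimRow₀
  A (rim (suc i))   = rimRow (suc i)

  Γ : Fin (suc m) → ℤ
  Γ t = δ t p0

  A-rows : ∀ u t → rowValue Γ (A u) t ≡ 0ℤ
  A-rows (spoke (suc i)) t = spokeRow-kills (suc i) Γ t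
  A-rows (rim (suc i))   t = rimRow-kills (suc i) Γ t
  A-rows (spoke zero)    t = trans
    (cong (λ s → 1ℤ - 1ℤ + - N * δ t p0 + Γ t * s) (trans (sum-const {suc m} 1ℤ) (ℤₚ.*-identityʳ N)))
    (cancel N (δ t p0))
    where
    cancel : ∀ N g → 1ℤ - 1ℤ + - N * g + g * N ≡ 0ℤ
    cancel = solve-∀
  A-rows (rim zero)      t = trans
    (cong₂ (λ d s → 1ℤ * δ t n0 - 1ℤ * d + (-1ℤ * δ t p0 + -1ℤ * δ t n0 + 1ℤ * δ t z) + Γ t * s)
           (δ-next-next t z) (trans (sum-cong-≗ (λ j → ℤₚ.*-identityˡ (δ j n0))) (sum-δ₁ n0)))
    (cancel (δ t n0) (δ t z) (δ t p0))
    where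
    cancel : ∀ a b c → 1ℤ * a - 1ℤ * b + (-1ℤ * c + -1ℤ * a + 1ℤ * b) + c * 1ℤ ≡ 0ℤ
    cancel = solve-∀

  A-adj : ∀ {u v} → Adj H u v → A u v ≢ 0ℤ
  A-adj {spoke (suc i)} (u~v , _) = spokeRow-adj (suc i) u~v
  A-adj {rim (suc i)}   (u~v , _) = rimRow-adj (suc i) u~v
  A-adj {spoke zero} {spoke j} _ = λ ()
  A-adj {spoke zero} {rim _} (sr (inj₁ refl) , u≁v) = ⊥-elim (u≁v (inj₁ (refl , refl)))
  A-adj {spoke zero} {rim j} (sr (inj₂ z≡j+1) , _) =
    ≢0-via (trans (cong (- N *_) (δ-≡ (trans (sym (prev-next j)) (cong prev (sym z≡j+1))))) (ℤₚ.*-identityʳ (- N))) λ ()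
  A-adj {rim zero} {spoke _} (rs (inj₁ refl) , u≁v) = ⊥-elim (u≁v (inj₂ (refl , refl)))
  A-adj {rim zero} {spoke _} (rs (inj₂ refl) , _) = ≢0-via (cong (1ℤ *_) (δ-refl n0)) λ ()
  A-adj {rim zero} {rim _} (rr (inj₁ refl) , _) =
    ≢0-via (pick₃₂ -1ℤ -1ℤ 1ℤ (δ-≢ (next≢prev {k} z)) (δ-refl n0) (δ-≢ (next≢id {suc k} z))) λ ()
  A-adj {rim zero} {rim j} (rr (inj₂ z≡j+1) , _) =
    ≢0-via (pick₃₁ -1ℤ -1ℤ 1ℤ (δ-≡ j≡p0) (trans (cong (λ x → δ x n0) j≡p0) (δ-≢′ (next≢prev {k} z)))
                               (trans (cong (λ x → δ x z) j≡p0) (δ-≢ (prev≢id {suc k} z)))) λ ()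
    where
    j≡p0 : j ≡ p0
    j≡p0 = trans (sym (prev-next j)) (cong prev (sym z≡j+1))

  A-support : ∀ u v → u ≢ v → A u v ≢ 0ℤ → Adj H u v
  A-support (spoke (suc i)) v u≢v ≢0 = spokeRow-support (suc i) v u≢v ≢0 , λ { (inj₁ (() , _)) ; (inj₂ (() , _)) }
  A-support (rim (suc i))   v u≢v ≢0 = rimRow-support (suc i) v u≢v ≢0 , λ { (inj₁ (() , _)) ; (inj₂ (() , _)) }
  A-support (spoke zero) (spoke j) u≢v _ = ss (u≢v ∘ cong spoke) , λ { (inj₁ (_ , ())) ; (inj₂ (() , _)) }
  A-support (spoke zero) (rim j) _ ≢0 = decide (j Finₚ.≟ p0)
    where
    decide : Dec (j ≡ p0) → Adj H (spoke zero) (rim j)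
    decide (yes j≡p0) = sr (inj₂ (sym (trans (cong next j≡p0) (next-prev z))))
                      , λ { (inj₁ (_ , e)) → prev≢id {suc k} z (trans (sym j≡p0) (rim-injective e)) ; (inj₂ (() , _)) }
    decide (no j≢p0)  = ⊥-elim (≢0 (trans (cong (- N *_) (δ-≢ j≢p0)) (ℤₚ.*-zeroʳ (- N))))
  A-support (rim zero) (spoke j) _ ≢0 = decide (j Finₚ.≟ n0)
    where
    decide : Dec (j ≡ n0) → Adj H (rim zero) (spoke j)
    decide (yes j≡n0) = rs (inj₂ j≡n0)
                      , λ { (inj₁ (() , _)) ; (inj₂ (_ , e)) → next≢id {suc k} z (trans (sym j≡n0) (spoke-injective e)) }
    decide (no j≢n0)  = ⊥-elim (≢0 (cong (1ℤ *_) (δ-≢ j≢n0)))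
  A-support (rim zero) (rim j) u≢v ≢0 = decide (j Finₚ.≟ p0) (j Finₚ.≟ n0)
    where
    decide : Dec (j ≡ p0) → Dec (j ≡ n0) → Adj H (rim zero) (rim j)
    decide (yes j≡p0) _ = rr (inj₂ (sym (trans (cong next j≡p0) (next-prev z)))) , λ { (inj₁ (() , _)) ; (inj₂ (_ , ())) }
    decide (no _) (yes j≡n0) = rr (inj₁ j≡n0) , λ { (inj₁ (() , _)) ; (inj₂ (_ , ())) }
    decide (no j≢p0) (no j≢n0) =
      ⊥-elim (≢0 (none₃ -1ℤ -1ℤ 1ℤ (δ-≢ j≢p0) (δ-≢ j≢n0) (δ-≢ (u≢v ∘ cong rim ∘ sym))))

  nullity : Nullity (spoke z) (rim z)
  nullity = record { A = A ; Γ = Γ ; A-adj = A-adj ; A-support = λ {u} {v} → A-support u v ; A-rows = A-rows }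

  -- Rim i forces spoke i+1 in turn, starting with rim 0, which no longer sees spoke 0.
  S : List (Edge m)
  S = tabulate rim

  rim-black : ∀ i → Black H S (rim i)
  rim-black i = init (∈ₚ.∈-tabulate⁺ {f = rim} i)

  rim-forces : ∀ i → (i ≢ z → Black H S (spoke i)) → Black H S (spoke (next i))
  rim-forces i spoke-i = force (rim-black i) (rs (inj₂ refl) , kept) others
    where
    kept : ¬ (((rim i ≡ spoke z) × (spoke (next i) ≡ rim z)) ⊎ ((rim i ≡ rim z) × (spoke (next i) ≡ spoke z)))
    kept (inj₂ (refl , e)) = next≢id {suc k} z (spoke-injective e)
    others : ∀ v → Adj H (rim i) v → v ≢ spoke (next i) → Black H S v
    others _ (rs (inj₁ refl) , u≁v) _ = spoke-i (λ i≡z → u≁v (inj₂ (cong rim i≡z , cong spoke i≡z)))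
    others _ (rs (inj₂ refl) , _) v≢w = ⊥-elim (v≢w refl)
    others _ (rr _ , _)          _   = rim-black _

  spoke-next-black : ∀ i → Black H S (spoke (next i))
  spoke-next-black = <-weakInduction (λ i → Black H S (spoke (next i))) (rim-forces z (λ z≢z → ⊥-elim (z≢z refl)))
    (λ j IH → rim-forces (suc j) (λ _ → subst (Black H S ∘ spoke) (next-inject₁ j) IH))

  zfs : IsZFS H S
  zfs (spoke i) = subst (Black H S ∘ spoke) (next-prev i) (spoke-next-black (prev i))
  zfs (rim i)   = rim-black i

  Z : ZeroForcingNumberIs H (suc m)
  Z = Z-determined nullity S (Uniqueₚ.tabulate⁺ rim-injective) (Listₚ.length-tabulate rim) zfs

-- Deleting the edge rim 0 — rim 1

module RimRim {k : ℕ} where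
  open StandardRows {k}

  z p0 n0 n1 : Fin (suc m)
  z  = zero
  p0 = prev z
  n0 = suc zero
  n1 = suc (suc zero)

  H : Graph
  H = deleteEdge (LineWheel m) (rim z) (rim n0)

  rimRow₀ : Edge m → ℤ
  rimRow₀ (spoke j) = + 2 * δ j z + -1ℤ * δ j n0
  rimRow₀ (rim j)   = + 2 * δ j p0 + - + 2 * δ j z

  rimRow₁ : Edge m → ℤ
  rimRow₁ (spoke j) = 1ℤ * δ j n0 + - + 2 * δ j n1
  rimRow₁ (rim j)   = + 2 * δ j n1 + - + 2 * δ j n0

  A : Edge m → Edge m → ℤ
  A (spoke i)             = spokeRow i
  A (rim zero)            = rimRow₀
  A (rim (suc zero))      = rimRow₁
  A (rim (suc (suc i)))   = rimRow (suc (suc i))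

  Γ : Fin (suc m) → ℤ
  Γ t = 1ℤ * δ t n0 + -1ℤ * δ t z

  A-rows : ∀ u t → rowValue Γ (A u) t ≡ 0ℤ
  A-rows (spoke i) t = spokeRow-kills i Γ t
  A-rows (rim (suc (suc i))) t = rimRow-kills (suc (suc i)) Γ t
  A-rows (rim zero) t = trans
    (cong₃ (δ-next-prev t z) (δ-next-next t z) (sum-δ₂ (+ 2) -1ℤ z n0))
    (cancel (δ t z) (δ t n0) (δ t p0))
    where
    cong₃ : ∀ {a a′ b b′ c c′} → a ≡ a′ → b ≡ b′ → c ≡ c′ →
      + 2 * δ t z + -1ℤ * δ t n0 - (+ 2 * a + -1ℤ * b) + (+ 2 * δ t p0 + - + 2 * δ t z) + Γ t * c ≡
      + 2 * δ t z + -1ℤ * δ t n0 - (+ 2 * a′ + -1ℤ * b′) + (+ 2 * δ t p0 + - + 2 * δ t z) + Γ t * c′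
    cong₃ refl refl refl = refl
    cancel : ∀ a b c → + 2 * a + -1ℤ * b - (+ 2 * c + -1ℤ * a) + (+ 2 * c + - + 2 * a)
                       + (1ℤ * b + -1ℤ * a) * (+ 2 + -1ℤ) ≡ 0ℤ
    cancel = solve-∀
  A-rows (rim (suc zero)) t = trans
    (cong₃ (δ-next-next t z) (δ-next-next t n0) (sum-δ₂ 1ℤ (- + 2) n0 n1))
    (cancel (δ t z) (δ t n0) (δ t n1))
    where
    cong₃ : ∀ {a a′ b b′ c c′} → a ≡ a′ → b ≡ b′ → c ≡ c′ →
      1ℤ * δ t n0 + - + 2 * δ t n1 - (1ℤ * a + - + 2 * b) + (+ 2 * δ t n1 + - + 2 * δ t n0) + Γ t * c ≡
      1ℤ * δ t n0 + - + 2 * δ t n1 - (1ℤ * a′ + - + 2 * b′) + (+ 2 * δ t n1 + - + 2 * δ t n0) + Γ t * c′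
    cong₃ refl refl refl = refl
    cancel : ∀ a b d → 1ℤ * b + - + 2 * d - (1ℤ * a + - + 2 * b) + (+ 2 * d + - + 2 * b)
                       + (1ℤ * b + -1ℤ * a) * (1ℤ + - + 2) ≡ 0ℤ
    cancel = solve-∀

  A-adj : ∀ {u v} → Adj H u v → A u v ≢ 0ℤ
  A-adj {spoke i}           (u~v , _) = spokeRow-adj i u~v
  A-adj {rim (suc (suc i))} (u~v , _) = rimRow-adj (suc (suc i)) u~v
  A-adj {rim zero} (rs (inj₁ refl) , _) = ≢0-via (pick₁ (+ 2) -1ℤ (δ-refl z) (δ-≢ {i = z} {n0} λ ())) λ ()
  A-adj {rim zero} (rs (inj₂ refl) , _) = ≢0-via (pick₂ (+ 2) -1ℤ (δ-≢ {i = n0} {z} λ ()) (δ-refl n0)) λ ()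
  A-adj {rim zero} (rr (inj₁ refl) , u≁v) = ⊥-elim (u≁v (inj₁ (refl , refl)))
  A-adj {rim zero} {rim j} (rr (inj₂ z≡j+1) , _) =
    ≢0-via (pick₁ (+ 2) (- + 2) (δ-≡ j≡p0) (trans (cong (λ x → δ x z) j≡p0) (δ-≢ (prev≢id {suc k} z)))) λ ()
    where
    j≡p0 : j ≡ p0
    j≡p0 = trans (sym (prev-next j)) (cong prev (sym z≡j+1))
  A-adj {rim (suc zero)} (rs (inj₁ refl) , _) = ≢0-via (pick₁ 1ℤ (- + 2) (δ-refl n0) (δ-≢ {i = n0} {n1} λ ())) λ ()
  A-adj {rim (suc zero)} (rs (inj₂ refl) , _) = ≢0-via (pick₂ 1ℤ (- + 2) (δ-≢ {i = n1} {n0} λ ()) (δ-refl n1)) λ ()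
  A-adj {rim (suc zero)} (rr (inj₁ refl) , _) = ≢0-via (pick₁ (+ 2) (- + 2) (δ-refl n1) (δ-≢ {i = n1} {n0} λ ())) λ ()
  A-adj {rim (suc zero)} {rim j} (rr (inj₂ n0≡j+1) , u≁v) =
    ⊥-elim (u≁v (inj₂ (refl , cong rim (trans (sym (prev-next j)) (cong prev (sym n0≡j+1))))))

  A-support : ∀ u v → u ≢ v → A u v ≢ 0ℤ → Adj H u v
  A-support (spoke i) v u≢v ≢0 = spokeRow-support i v u≢v ≢0 , λ { (inj₁ (() , _)) ; (inj₂ (() , _)) }
  A-support (rim (suc (suc i))) v u≢v ≢0 =
    rimRow-support (suc (suc i)) v u≢v ≢0 , λ { (inj₁ (() , _)) ; (inj₂ (() , _)) }
  A-support (rim zero) (spoke j) _ ≢0 = decide (j Finₚ.≟ z) (j Finₚ.≟ n0)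
    where
    decide : Dec (j ≡ z) → Dec (j ≡ n0) → Adj H (rim zero) (spoke j)
    decide (yes j≡z) _ = rs (inj₁ j≡z) , λ { (inj₁ (_ , ())) ; (inj₂ (() , _)) }
    decide (no _) (yes j≡n0) = rs (inj₂ j≡n0) , λ { (inj₁ (_ , ())) ; (inj₂ (() , _)) }
    decide (no j≢z) (no j≢n0) = ⊥-elim (≢0 (none₂ (+ 2) -1ℤ (δ-≢ j≢z) (δ-≢ j≢n0)))
  A-support (rim zero) (rim j) u≢v ≢0 = decide (j Finₚ.≟ p0)
    where
    decide : Dec (j ≡ p0) → Adj H (rim zero) (rim j)
    decide (yes j≡p0) = rr (inj₂ (sym (trans (cong next j≡p0) (next-prev z))))
      , λ { (inj₁ (_ , e)) → next≢prev {k} z (sym (trans (sym j≡p0) (rim-injective e))) ; (inj₂ (() , _)) }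
    decide (no j≢p0) = ⊥-elim (≢0 (none₂ (+ 2) (- + 2) (δ-≢ j≢p0) (δ-≢ (u≢v ∘ cong rim ∘ sym))))
  A-support (rim (suc zero)) (spoke j) _ ≢0 = decide (j Finₚ.≟ n0) (j Finₚ.≟ n1)
    where
    decide : Dec (j ≡ n0) → Dec (j ≡ n1) → Adj H (rim n0) (spoke j)
    decide (yes j≡n0) _ = rs (inj₁ j≡n0) , λ { (inj₁ (() , _)) ; (inj₂ (_ , ())) }
    decide (no _) (yes j≡n1) = rs (inj₂ j≡n1) , λ { (inj₁ (() , _)) ; (inj₂ (_ , ())) }
    decide (no j≢n0) (no j≢n1) = ⊥-elim (≢0 (none₂ 1ℤ (- + 2) (δ-≢ j≢n0) (δ-≢ j≢n1)))
  A-support (rim (suc zero)) (rim j) u≢v ≢0 = decide (j Finₚ.≟ n1)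
    where
    decide : Dec (j ≡ n1) → Adj H (rim n0) (rim j)
    decide (yes refl) = rr (inj₁ refl) , λ { (inj₁ (() , _)) ; (inj₂ (_ , ())) }
    decide (no j≢n1) = ⊥-elim (≢0 (none₂ (+ 2) (- + 2) (δ-≢ j≢n1) (δ-≢ (u≢v ∘ cong rim ∘ sym))))

  nullity : Nullity (rim z) (rim n0)
  nullity = record { A = A ; Γ = Γ ; A-adj = A-adj ; A-support = λ {u} {v} → A-support u v ; A-rows = A-rows }

  -- Rims 1, …, m−1 force spokes 2, …, m in turn, then spoke 2 forces spoke 0 and spoke 0 forces rim 0.
  S : List (Edge m)
  S = spoke n0 ∷ tabulate (rim ∘ suc)

  rim-black : ∀ {i} → i ≢ z → Black H S (rim i)
  rim-black {zero}  0≢0 = ⊥-elim (0≢0 refl)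
  rim-black {suc i} _   = init (there (∈ₚ.∈-tabulate⁺ {f = rim ∘ suc} i))

  spoke-black⁺ : ∀ {j} → n0 Fin.≤ j → Black H S (spoke j)
  spoke-black⁺ = upward (Black H S ∘ spoke) (init (here refl)) step
    where
    step : ∀ j → n0 Fin.≤ inject₁ j → Black H S (spoke (inject₁ j)) → Black H S (spoke (suc j))
    step j 1≤j IH = force (rim-black j≢0) (rs (inj₂ (sym (next-inject₁ j))) , λ { (inj₁ (_ , ())) ; (inj₂ (_ , ())) })
                          others
      where
      j≢0 : inject₁ j ≢ z
      j≢0 j≡0 = ℕₚ.<⇒≢ 1≤j (sym (cong toℕ j≡0))
      others : ∀ v → Adj H (rim (inject₁ j)) v → v ≢ spoke (suc j) → Black H S v
      others _ (rs (inj₁ refl) , _) _ = IH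
      others _ (rs (inj₂ refl) , _) v≢w = ⊥-elim (v≢w (cong spoke (next-inject₁ j)))
      others _ (rr (inj₁ refl) , _) _ = rim-black (λ e → Finₚ.0≢1+n (trans (sym e) (next-inject₁ j)))
      others _ (rr {j = l} (inj₂ j≡l+1) , u≁v) _ with l Finₚ.≟ z
      ... | no l≢0    = rim-black l≢0
      ... | yes refl  = ⊥-elim (u≁v (inj₂ (cong rim j≡l+1 , refl)))

  spoke-black : ∀ j → Black H S (spoke j)
  spoke-black (suc j) = spoke-black⁺ (s≤s z≤n)
  spoke-black zero    = force (spoke-black⁺ {n1} (s≤s z≤n)) (ss (λ ()) , λ { (inj₁ (() , _)) ; (inj₂ (() , _)) }) others
    where
    others : ∀ v → Adj H (spoke n1) v → v ≢ spoke z → Black H S v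
    others (spoke zero)    _ v≢w = ⊥-elim (v≢w refl)
    others (spoke (suc j)) _ _   = spoke-black⁺ (s≤s z≤n)
    others _ (sr (inj₁ refl) , _) _ = rim-black λ ()
    others _ (sr (inj₂ e) , _)    _ = rim-black (λ j≡0 → n1≢n0 (trans e (cong next j≡0)))
      where
      n1≢n0 : n1 ≢ n0
      n1≢n0 ()

  zfs : IsZFS H S
  zfs (spoke j)     = spoke-black j
  zfs (rim (suc i)) = rim-black λ ()
  zfs (rim zero)    = force (spoke-black z) (sr (inj₁ refl) , λ { (inj₁ (() , _)) ; (inj₂ (() , _)) }) others
    where
    others : ∀ v → Adj H (spoke z) v → v ≢ rim z → Black H S v
    others _ (ss _ , _)          _   = spoke-black _
    others _ (sr (inj₁ refl) , _) v≢w = ⊥-elim (v≢w refl)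
    others _ (sr (inj₂ e) , _)   _   = rim-black (λ l≡0 → next≢id {suc k} z (trans (cong next (sym l≡0)) (sym e)))

  Z : ZeroForcingNumberIs H (suc m)
  Z = Z-determined nullity S
        (Allₚ.tabulate⁺ {f = rim ∘ suc} (λ _ ()) ∷ Uniqueₚ.tabulate⁺ (Finₚ.suc-injective ∘ rim-injective))
                     (cong suc (Listₚ.length-tabulate (rim ∘ suc))) zfs

-- Deleting the edge spoke 0 — spoke q

module SpokeSpoke {k : ℕ} where
  open StandardRows {k}

  M : ℤ
  M = + m

  -- The row of spoke a once its edge to spoke b is deleted.
  cutSpokeRow : Fin (suc m) → Fin (suc m) → Edge m → ℤ
  cutSpokeRow a b (spoke j) = 1ℤ + - N * δ j a + -1ℤ * δ j b
  cutSpokeRow a b (rim j)   = M * δ j a + - M * δ j (prev a)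

  Γ₂ : Fin (suc m) → Fin (suc m) → Fin (suc m) → ℤ
  Γ₂ a b t = δ t (prev a) + δ t (prev b) + -1ℤ * δ t a + -1ℤ * δ t b

  cutSpokeRow-kills : ∀ a b t → rowValue (Γ₂ a b) (cutSpokeRow a b) t ≡ 0ℤ
  cutSpokeRow-kills a b t = trans
    (cong₃ (δ-next-prev t a) (δ-next-prev t b) spokeSum≡-1)
    (cancel M (δ t a) (δ t b) (δ t (prev a)) (δ t (prev b)))
    where
    spokeSum≡-1 : spokeSum (cutSpokeRow a b) ≡ -1ℤ
    spokeSum≡-1 = trans (sum-affine₂ 1ℤ (- N) -1ℤ a b) (lemma M)
      where lemma : ∀ M → (1ℤ + M) * 1ℤ + - (1ℤ + M) + -1ℤ ≡ -1ℤ
            lemma = solve-∀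
    cong₃ : ∀ {x x′ y y′ c c′} → x ≡ x′ → y ≡ y′ → c ≡ c′ →
      1ℤ + - N * δ t a + -1ℤ * δ t b - (1ℤ + - N * x + -1ℤ * y) + (M * δ t a + - M * δ t (prev a)) + Γ₂ a b t * c ≡
      1ℤ + - N * δ t a + -1ℤ * δ t b - (1ℤ + - N * x′ + -1ℤ * y′) + (M * δ t a + - M * δ t (prev a)) + Γ₂ a b t * c′
    cong₃ refl refl refl = refl
    cancel : ∀ M a b c d → 1ℤ + - (1ℤ + M) * a + -1ℤ * b - (1ℤ + - (1ℤ + M) * c + -1ℤ * d) + (M * a + - M * c)
                           + (c + d + -1ℤ * a + -1ℤ * b) * -1ℤ ≡ 0ℤ
    cancel = solve-∀

  Γ₂-comm : ∀ a b t → Γ₂ a b t ≡ Γ₂ b a t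
  Γ₂-comm a b t = lemma (δ t (prev a)) (δ t (prev b)) (δ t a) (δ t b)
    where lemma : ∀ w x y z → w + x + -1ℤ * y + -1ℤ * z ≡ x + w + -1ℤ * z + -1ℤ * y
          lemma = solve-∀

  cutSpokeRow-adj : ∀ a b {v} → Meet (spoke a) v → v ≢ spoke b → cutSpokeRow a b v ≢ 0ℤ
  cutSpokeRow-adj a b (ss {j = j} a≢j) j≢b =
    ≢0-via (trans (cong₂ (λ x y → 1ℤ + - N * x + -1ℤ * y) (δ-≢′ a≢j) (δ-≢ (j≢b ∘ cong spoke))) (lemma N)) λ ()
    where lemma : ∀ N → 1ℤ + - N * 0ℤ + -1ℤ * 0ℤ ≡ 1ℤ
          lemma = solve-∀
  cutSpokeRow-adj a b (sr (inj₁ refl)) _ = ≢0-via (pick₁ M (- M) (δ-refl a) (δ-≢′ (prev≢id {suc k} a))) λ ()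
  cutSpokeRow-adj _ b (sr {j = j} (inj₂ refl)) _ =
    ≢0-via (pick₂ M (- M) (δ-≢′ (next≢id {suc k} j)) (δ-≡ (sym (prev-next j)))) λ ()

  cutSpokeRow-support : ∀ a b v → spoke a ≢ v → cutSpokeRow a b v ≢ 0ℤ → Meet (spoke a) v × v ≢ spoke b
  cutSpokeRow-support a b (spoke j) a≢j ≢0 = ss (a≢j ∘ cong spoke) , λ j≡b → ≢0
    (trans (cong₂ (λ x y → 1ℤ + - N * x + -1ℤ * y) (δ-≢ (a≢j ∘ cong spoke ∘ sym)) (δ-≡ (spoke-injective j≡b)))
           (lemma N))
    where lemma : ∀ N → 1ℤ + - N * 0ℤ + -1ℤ * 1ℤ ≡ 0ℤ
          lemma = solve-∀
  cutSpokeRow-support a b (rim j) _ ≢0 = decide (j Finₚ.≟ a) (j Finₚ.≟ prev a) , λ ()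
    where
    decide : Dec (j ≡ a) → Dec (j ≡ prev a) → Meet (spoke a) (rim j)
    decide (yes j≡a) _ = sr (inj₁ (sym j≡a))
    decide (no _) (yes j≡a-1) = sr (inj₂ (trans (sym (next-prev a)) (cong next (sym j≡a-1))))
    decide (no j≢a) (no j≢a-1) = ⊥-elim (≢0 (none₂ M (- M) (δ-≢ j≢a) (δ-≢ j≢a-1)))

  module _ (q : Fin (suc m)) (q≢0 : q ≢ zero) where

    H : Graph
    H = deleteEdge (LineWheel m) (spoke zero) (spoke q)

    spokeRowAt : ∀ i → Dec (i ≡ q) → Edge m → ℤ
    spokeRowAt i (yes _) = cutSpokeRow q zero
    spokeRowAt i (no _)  = spokeRow i

    A : Edge m → Edge m → ℤ
    A (spoke zero)    = cutSpokeRow zero q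
    A (spoke (suc i)) = spokeRowAt (suc i) (suc i Finₚ.≟ q)
    A (rim i)         = rimRow i

    A-rows : ∀ u t → rowValue (Γ₂ zero q) (A u) t ≡ 0ℤ
    A-rows (spoke zero) t = cutSpokeRow-kills zero q t
    A-rows (spoke (suc i)) t with suc i Finₚ.≟ q
    ... | no _  = spokeRow-kills (suc i) (Γ₂ zero q) t
    ... | yes _ = trans (cong (λ g → rowValue (λ _ → g) (cutSpokeRow q zero) t) (Γ₂-comm zero q t))
                        (cutSpokeRow-kills q zero t)
    A-rows (rim i) t = rimRow-kills i (Γ₂ zero q) t

    A-adj : ∀ {u v} → Adj H u v → A u v ≢ 0ℤ
    A-adj {spoke zero} (u~v , u≁v) = cutSpokeRow-adj zero q u~v (λ v≡q → u≁v (inj₁ (refl , v≡q)))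
    A-adj {spoke (suc i)} {v} (u~v , u≁v) with suc i Finₚ.≟ q
    ... | no _     = spokeRow-adj (suc i) u~v
    ... | yes refl = cutSpokeRow-adj q zero u~v (λ v≡0 → u≁v (inj₂ (refl , v≡0)))
    A-adj {rim i} (u~v , _) = rimRow-adj i u~v

    A-support : ∀ u v → u ≢ v → A u v ≢ 0ℤ → Adj H u v
    A-support (spoke zero) v u≢v ≢0 =
      let u~v , v≢q = cutSpokeRow-support zero q v u≢v ≢0
      in u~v , λ { (inj₁ (_ , v≡q)) → v≢q v≡q ; (inj₂ (0≡q , _)) → q≢0 (sym (spoke-injective 0≡q)) }
    A-support (spoke (suc i)) v u≢v ≢0 with suc i Finₚ.≟ q
    ... | no i≢q = spokeRow-support (suc i) v u≢v ≢0
                 , λ { (inj₁ (() , _)) ; (inj₂ (i≡q , _)) → i≢q (spoke-injective i≡q) }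
    ... | yes refl =
      let u~v , v≢0 = cutSpokeRow-support q zero v u≢v ≢0
      in u~v , λ { (inj₁ (() , _)) ; (inj₂ (_ , v≡0)) → v≢0 v≡0 }
    A-support (rim i) v u≢v ≢0 = rimRow-support i v u≢v ≢0 , λ { (inj₁ (() , _)) ; (inj₂ (() , _)) }

    nullity : Nullity (spoke zero) (spoke q)
    nullity = record { A = A ; Γ = Γ₂ zero q ; A-adj = A-adj ; A-support = λ {u} {v} → A-support u v ; A-rows = A-rows }

    -- Spoke q forces rim q−1, the black rims spread in both directions away from q until they reach
    -- the two rims at vertex 0, and finally any third spoke forces spoke 0.
    S : List (Edge m)
    S = rim q ∷ tabulate (spoke ∘ suc)

    spoke-black : ∀ {j} → j ≢ zero → Black H S (spoke j)
    spoke-black {zero}  0≢0 = ⊥-elim (0≢0 refl)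
    spoke-black {suc j} _   = init (there (∈ₚ.∈-tabulate⁺ {f = spoke ∘ suc} j))

    rim-before-q : Black H S (rim (prev q))
    rim-before-q = force (spoke-black q≢0) (sr (inj₂ (sym (next-prev q))) , λ { (inj₁ (_ , ())) ; (inj₂ (_ , ())) })
                         others
      where
      others : ∀ v → Adj H (spoke q) v → v ≢ rim (prev q) → Black H S v
      others (spoke j) (_ , u≁v) _ = spoke-black (λ j≡0 → u≁v (inj₂ (refl , cong spoke j≡0)))
      others _ (sr (inj₁ refl) , _) _   = init (here refl)
      others _ (sr (inj₂ e) , _)    v≢w = ⊥-elim (v≢w (cong rim (trans (sym (prev-next _)) (cong prev (sym e)))))

    rim-forces-next : ∀ i → i ≢ zero → next i ≢ zero →
      Black H S (rim i) → Black H S (rim (prev i)) → Black H S (rim (next i))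
    rim-forces-next i i≢0 i+1≢0 bi bi-1 = force bi (rr (inj₁ refl) , λ { (inj₁ (() , _)) ; (inj₂ (() , _)) }) others
      where
      others : ∀ v → Adj H (rim i) v → v ≢ rim (next i) → Black H S v
      others _ (rs (inj₁ refl) , _) _   = spoke-black i≢0
      others _ (rs (inj₂ refl) , _) _   = spoke-black i+1≢0
      others _ (rr (inj₁ refl) , _) v≢w = ⊥-elim (v≢w refl)
      others _ (rr {j = j} (inj₂ i≡j+1) , _) _ = subst (Black H S ∘ rim) (trans (cong prev i≡j+1) (prev-next j)) bi-1

    rim-forces-prev : ∀ i → i ≢ zero → next i ≢ zero →
      Black H S (rim i) → Black H S (rim (next i)) → Black H S (rim (prev i))
    rim-forces-prev i i≢0 i+1≢0 bi bi+1 =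
      force bi (rr (inj₂ (sym (next-prev i))) , λ { (inj₁ (() , _)) ; (inj₂ (() , _)) }) others
      where
      others : ∀ v → Adj H (rim i) v → v ≢ rim (prev i) → Black H S v
      others _ (rs (inj₁ refl) , _) _   = spoke-black i≢0
      others _ (rs (inj₂ refl) , _) _   = spoke-black i+1≢0
      others _ (rr (inj₁ refl) , _) _   = bi+1
      others _ (rr {j = j} (inj₂ i≡j+1) , _) v≢w =
        ⊥-elim (v≢w (cong rim (trans (sym (prev-next j)) (cong prev (sym i≡j+1)))))

    rim-black-from-q : ∀ {j} → q Fin.≤ j → Black H S (rim j)
    rim-black-from-q = proj₁ ∘ upward (λ i → Black H S (rim i) × Black H S (rim (prev i)))
                                       (init (here refl) , rim-before-q) step
      where
      step : ∀ j → q Fin.≤ inject₁ j → Black H S (rim (inject₁ j)) × Black H S (rim (prev (inject₁ j))) →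
             Black H S (rim (suc j)) × Black H S (rim (inject₁ j))
      step j q≤j (bj , bj-1) =
        subst (Black H S ∘ rim) (next-inject₁ j)
              (rim-forces-next (inject₁ j) j≢0 (λ e → Finₚ.0≢1+n (trans (sym e) (next-inject₁ j))) bj bj-1)
        , bj
        where
        j≢0 : inject₁ j ≢ zero
        j≢0 j≡0 = q≢0 (Finₚ.toℕ-injective (ℕₚ.n≤0⇒n≡0 (subst (λ x → toℕ q ℕ.≤ toℕ x) j≡0 q≤j)))

    rim-black-before-q : ∀ {j} → j Fin.≤ prev q → Black H S (rim j)
    rim-black-before-q = proj₁ ∘ downward (λ i → Black H S (rim i) × Black H S (rim (next i)))
                                          (rim-before-q , subst (Black H S ∘ rim) (sym (next-prev q)) (init (here refl)))
                                          step
      where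
      step : ∀ j → suc j Fin.≤ prev q → Black H S (rim (suc j)) × Black H S (rim (next (suc j))) →
             Black H S (rim (inject₁ j)) × Black H S (rim (next (inject₁ j)))
      step j 1+j≤q-1 (bj+1 , bj+2) =
        rim-forces-prev (suc j) (λ ()) (next≢zero (ℕₚ.≤-<-trans 1+j≤q-1 (prev<m q≢0))) bj+1 bj+2
        , subst (Black H S ∘ rim) (sym (next-inject₁ j)) bj+1

    rim-black : ∀ j → Black H S (rim j)
    rim-black j with q Finₚ.≤? j
    ... | yes q≤j = rim-black-from-q q≤j
    ... | no  q≰j = rim-black-before-q (<⇒≤prev (ℕₚ.≰⇒> q≰j))

    spoke0-forced-by : ∀ c → c ≢ zero → c ≢ q → Black H S (spoke zero)
    spoke0-forced-by c c≢0 c≢q = force (spoke-black c≢0) (ss c≢0 , kept) others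
      where
      kept : ¬ (((spoke c ≡ spoke zero) × (spoke zero ≡ spoke q)) ⊎ ((spoke c ≡ spoke q) × (spoke zero ≡ spoke zero)))
      kept (inj₁ (e , _)) = c≢0 (spoke-injective e)
      kept (inj₂ (e , _)) = c≢q (spoke-injective e)
      others : ∀ v → Adj H (spoke c) v → v ≢ spoke zero → Black H S v
      others (spoke j) _ v≢w = spoke-black (v≢w ∘ cong spoke)
      others (rim j)   _ _   = rim-black j

    spoke0-black : Black H S (spoke zero)
    spoke0-black with q Finₚ.≟ suc zero
    ... | yes refl = spoke0-forced-by (suc (suc zero)) (λ ()) (λ ())
    ... | no  q≢1  = spoke0-forced-by (suc zero) (λ ()) (q≢1 ∘ sym)

    zfs : IsZFS H S
    zfs (spoke zero)    = spoke0-black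
    zfs (spoke (suc j)) = spoke-black λ ()
    zfs (rim j)         = rim-black j

    Z : ZeroForcingNumberIs H (suc m)
    Z = Z-determined nullity S
          (Allₚ.tabulate⁺ {f = spoke ∘ suc} (λ _ ()) ∷ Uniqueₚ.tabulate⁺ (Finₚ.suc-injective ∘ spoke-injective))
                       (cong suc (Listₚ.length-tabulate (spoke ∘ suc))) zfs

-- Every edge of LineWheel m is, up to symmetry, one of the three cases above

module _ {k : ℕ} where
  private
    m : ℕ
    m = suc (suc k)

    ZDel : Edge m → Edge m → Set
    ZDel u v = ZeroForcingNumberIs (deleteEdge (LineWheel m) u v) (suc m)

  ZDel-comm : ∀ {u v} → ZDel v u → ZDel u v
  ZDel-comm {u} {v} = ZeroForcingNumberIs-≅ (deleteEdge-comm (LineWheel m) v u)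

  ZDel-rotate : ∀ (i : Fin (suc m)) {u v} → ZDel (relabel (prevⁿ {m} (toℕ i)) u) (relabel (prevⁿ {m} (toℕ i)) v) → ZDel u v
  ZDel-rotate i {u} {v} Z = deleteEdge-transport (rotation^ {m} (toℕ i)) u v
    (subst₂ ZDel (sym (rotation^-relabel {m} (toℕ i) u)) (sym (rotation^-relabel {m} (toℕ i) v)) Z)

  ZDel-spoke-rim : ∀ i → ZDel (spoke i) (rim i)
  ZDel-spoke-rim i = ZDel-rotate i (subst₂ ZDel (cong spoke (sym (prevⁿ-toℕ i))) (cong rim (sym (prevⁿ-toℕ i)))
                                              (SpokeRim.Z {k}))

  ZDel-spoke-next-rim : ∀ j → ZDel (spoke (next j)) (rim j)
  ZDel-spoke-next-rim j = deleteEdge-transport reflection (spoke (next j)) (rim j) (ZDel-spoke-rim (opposite (next j)))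

  ZDel-rim-rim : ∀ i → ZDel (rim i) (rim (next i))
  ZDel-rim-rim i = ZDel-rotate i
    (subst₂ ZDel (cong rim (sym i↦0)) (cong rim (sym (trans (prevⁿ-next (toℕ i) i) (cong next i↦0)))) (RimRim.Z {k}))
    where
    i↦0 = prevⁿ-toℕ i

  ZDel-spoke-spoke : ∀ {i j} → i ≢ j → ZDel (spoke i) (spoke j)
  ZDel-spoke-spoke {i} {j} i≢j = ZDel-rotate i
    (subst (λ x → ZDel x (spoke (prevⁿ {m} (toℕ i) j))) (cong spoke (sym i↦0)) (SpokeSpoke.Z {k} _ j↦≢0))
    where
    i↦0 = prevⁿ-toℕ i
    j↦≢0 : prevⁿ {m} (toℕ i) j ≢ zero
    j↦≢0 e = i≢j (prevⁿ-injective (toℕ i) (trans i↦0 (sym e)))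

  ZDel-Meet : ∀ {u v} → Meet u v → ZDel u v
  ZDel-Meet (ss i≢j)                  = ZDel-spoke-spoke i≢j
  ZDel-Meet (sr (inj₁ refl))          = ZDel-spoke-rim _
  ZDel-Meet (sr (inj₂ refl))          = ZDel-spoke-next-rim _
  ZDel-Meet (rs (inj₁ refl))          = ZDel-comm (ZDel-spoke-rim _)
  ZDel-Meet (rs (inj₂ refl))          = ZDel-comm (ZDel-spoke-next-rim _)
  ZDel-Meet (rr (inj₁ refl))          = ZDel-rim-rim _
  ZDel-Meet (rr (inj₂ refl))          = ZDel-comm (ZDel-rim-rim _)

proposition3p18 : (n : ℕ) → 3 ≤ n → (x y : V (LW n)) → Adj (LW n) x y →
    ZeroForcingNumberIs (deleteEdge (LW n) x y) n
proposition3p18 .(suc (suc (suc k))) (s≤s (s≤s (s≤s {n = k} _))) x y x~y =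
  deleteEdge-transport (≅-sym LineWheel≅LW) x y (ZDel-Meet (from-adj LineWheel≅LW x~y))
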